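{- Let $\boldsymbol{Z}=\{z_{i,j}=(x_{i,j},y_{i,j})\in\mathbb{F}^2 : i,j\in\mathbb{N}\}$ be a node set. Then, as an identity of formal power series in $s,t$ with coefficients in $\mathbb{F}[x,y]$, $$(1-s)^{ -x}(1-t)^{ -y}=\sum_{m=0}^{\infty}\sum_{n=0}^{\infty}\tilde g_{m,n}((x,y);\boldsymbol{Z})\,\frac{s^m}{(1-s)^{x_{m,n}}\,m!}\,\frac{t^n}{(1-t)^{y_{m,n}}\,n!}.$$
   Context: $\mathbb{F}$ is a field of characteristic zero. For $p\in\mathbb{F}[x,y]$, the backward difference operators are $\Delta_x p(x,y)=p(x,y)-p(x-1,y)$ and $\Delta_y p(x,y)=p(x,y)-p(x,y-1)$. For $z\in\mathbb{F}^2$, $\varepsilon(z)$ denotes evaluation of a polynomial at $(x,y)=z$. Write $(i,j)\preceq(m,n)$ if $i\le m$ and $j\le n$. $\Pi^2_{m,n}$ is the space of polynomials in $\mathbb{F}[x,y]$ of degree at most $m$ in $x$ and at most $n$ in $y$. For $m,n\in\mathbb{N}$ the bivariate difference Gončarov polynomial $\tilde g_{m,n}((x,y);\boldsymbol{Z})$ is the unique polynomial in $\Pi^2_{m,n}$ satisfying $\varepsilon(z_{i,j})\Delta_x^i\Delta_y^j\tilde g_{m,n}((x,y);\boldsymbol{Z})=m!\,n!\,\delta_{m,i}\delta_{n,j}$ for all $(i,j)\preceq(m,n)$. The upper factorial is $t^{(0)}=1$, $t^{(k)}=t(t+1)\cdots(t+k-1)$, and $(1-s)^{ -a}$ denotes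 the formal series $\sum_{k\ge0}a^{(k)}s^k/k!$. -}

module Defs where

open import Level using (_⊔_) renaming (suc to lsuc)
open import Data.Nat as ℕ using (ℕ; zero; suc; _≤_; _<_; _∸_)
open import Data.Nat using (_!)
open import Data.Product using (_×_; proj₁; proj₂)
open import Data.Sum using (_⊎_)
open import Data.Bool using (if_then_else_)
open import Relation.Nullary using (¬_)
open import Relation.Nullary.Decidable using (⌊_⌋)
open import Algebra.Bundles using (CommutativeRing)

-- Fields (with a total inverse whose value at 0 is irrelevant)

record Field c ℓ : Set (lsuc (c ⊔ ℓ)) where
  field
    commutativeRing : CommutativeRing c ℓ
  open CommutativeRing commutativeRing public
  field
    _⁻¹       : Carrier → Carrier
    ⁻¹-inverse : ∀ x → ¬ (x ≈ 0#) → (x * (x ⁻¹)) ≈ 1#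
    1≉0       : ¬ (1# ≈ 0#)

module WithField {c ℓ} (F : Field c ℓ) where
  open Field F

  fromℕ : ℕ → Carrier
  fromℕ zero    = 0#
  fromℕ (suc n) = 1# + fromℕ n

  CharZero : Set ℓ
  CharZero = ∀ n → ¬ (fromℕ (suc n) ≈ 0#)

  _^_ : Carrier → ℕ → Carrier
  u ^ zero  = 1#
  u ^ suc k = u * (u ^ k)

  δ : ℕ → ℕ → Carrier
  δ m i = if ⌊ m ℕ.≟ i ⌋ then 1# else 0#

  sumTo : ℕ → (ℕ → Carrier) → Carrier
  sumTo zero    f = f 0
  sumTo (suc n) f = sumTo n f + f (suc n)

  -- F[x,y]: a polynomial is given by its coefficients, p i j = coefficient
  -- of x^i y^j (equality is coefficientwise).

  Pol : Set c
  Pol = ℕ → ℕ → Carrier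

  _≈ᴾ_ : Pol → Pol → Set ℓ
  p ≈ᴾ q = ∀ i j → p i j ≈ q i j

  _+ᴾ_ : Pol → Pol → Pol
  (p +ᴾ q) i j = p i j + q i j

  _*ᴾ_ : Pol → Pol → Pol
  (p *ᴾ q) i j = sumTo i λ a → sumTo j λ b → p a b * q (i ∸ a) (j ∸ b)

  constᴾ : Carrier → Pol
  constᴾ u zero zero = u
  constᴾ u _    _    = 0#

  Xᴾ : Pol
  Xᴾ (suc zero) zero = 1#
  Xᴾ _          _    = 0#

  Yᴾ : Pol
  Yᴾ zero (suc zero) = 1#
  Yᴾ _    _          = 0#

  rising : Pol → ℕ → Pol
  rising p zero    = constᴾ 1#
  rising p (suc k) = rising p k *ᴾ (p +ᴾ constᴾ (fromℕ k))

  InΠ : ℕ → ℕ → Pol → Set ℓ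
  InΠ m n p = ∀ i j → (m < i ⊎ n < j) → p i j ≈ 0#

  evalΠ : ℕ → ℕ → Pol → Carrier → Carrier → Carrier
  evalΠ m n p u v = sumTo m λ i → sumTo n λ j → p i j * ((u ^ i) * (v ^ j))

  Δx : (Carrier → Carrier → Carrier) → (Carrier → Carrier → Carrier)
  Δx f u v = f u v - f (u - 1#) v

  Δy : (Carrier → Carrier → Carrier) → (Carrier → Carrier → Carrier)
  Δy f u v = f u v - f u (v - 1#)

  iter : ∀ {A : Set c} → (A → A) → ℕ → A → A
  iter g zero    a = a
  iter g (suc k) a = g (iter g k a)

  NodeSet : Set c
  NodeSet = ℕ → ℕ → Carrier × Carrier

  IsGoncarov : NodeSet → ℕ → ℕ → Pol → Set ℓ
  IsGoncarov Z m n p =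
    InΠ m n p ×
    (∀ i j → i ≤ m → j ≤ n →
      iter Δx i (iter Δy j (evalΠ m n p)) (proj₁ (Z i j)) (proj₂ (Z i j))
        ≈ (fromℕ (m !) * fromℕ (n !)) * (δ m i * δ n j))

  -- Formal power series in s,t with coefficients in F[x,y]:
  -- S a b = coefficient of s^a t^b.

  Ser : Set c
  Ser = ℕ → ℕ → Pol

  _≈ˢ_ : Ser → Ser → Set ℓ
  S ≈ˢ T = ∀ a b → S a b ≈ᴾ T a b

  _*ˢ_ : Ser → Ser → Ser
  (S *ˢ T) a b i j =
    sumTo a λ a' → sumTo b λ b' → (S a' b' *ᴾ T (a ∸ a') (b ∸ b')) i j

  constˢ : Pol → Ser
  constˢ p zero zero = p
  constˢ p _    _    = constᴾ 0#

  monoˢ : ℕ → ℕ → Ser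
  monoˢ m n a b =
    if ⌊ m ℕ.≟ a ⌋ then (if ⌊ n ℕ.≟ b ⌋ then constᴾ 1# else constᴾ 0#)
    else constᴾ 0#

  -- (1-s)^{-p} = Σ_k p^(k) s^k / k!
  oneMinusS^- : Pol → Ser
  oneMinusS^- p k zero    = rising p k *ᴾ constᴾ (fromℕ (k !) ⁻¹)
  oneMinusS^- p k (suc _) = constᴾ 0#

  -- (1-t)^{-p} = Σ_k p^(k) t^k / k!
  oneMinusT^- : Pol → Ser
  oneMinusT^- p zero    k = rising p k *ᴾ constᴾ (fromℕ (k !) ⁻¹)
  oneMinusT^- p (suc _) k = constᴾ 0#

  -- Σ_{m,n ≥ 0} T m n for a family in which T m n is divisible by s^m t^n
  -- (so the sum is formally convergent): the coefficient of s^a t^b only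
  -- receives contributions from m ≤ a, n ≤ b.
  sumˢ : (ℕ → ℕ → Ser) → Ser
  sumˢ T a b i j = sumTo a λ m → sumTo b λ n → T m n a b i j

  invℕ : ℕ → Carrier
  invℕ k = fromℕ k ⁻¹

-- Comparing coefficients of s^a t^b, the identity says that
--   x^(a) y^(b) / (a! b!) = Σ_{m ≤ a, n ≤ b} g̃_{m,n}(x,y) κ_{m,n},
--   κ_{m,n} = x_{m,n}^(a-m) y_{m,n}^(b-n) / ((a-m)! m! (b-n)! n!).
-- Both sides lie in Π²_{a,b}, so by uniqueness of Gončarov interpolation it suffices that every
-- functional ε(z_{i,j}) Δx^i Δy^j with (i,j) ⪯ (a,b) takes the same value on them. On the left,
-- Δ_u (u^(k) / k!) = u^(k-1) / (k-1)! gives x_{i,j}^(a-i) y_{i,j}^(b-j) / ((a-i)! (b-j)!); on the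
-- right, the defining property of g̃ selects the single term (m,n) = (i,j), with the same value.
-- Uniqueness is proved by descending induction on the degree: i backward differences of a
-- polynomial of x-degree i leave i! times its leading coefficient, and i! is invertible in
-- characteristic zero.

module Submission where

open import Defs
open import Data.Nat using (ℕ)
open import Data.Nat using (_!)
open import Data.Product using (proj₁; proj₂)

open import Level using (_⊔_)
open import Data.Nat using (zero; suc; _≤_; _<_; z≤n; s≤s; _∸_; _≟_; _≤?_)
import Data.Nat as ℕ
import Data.Nat.Properties as ℕ
open import Data.Integer as ℤ using (ℤ; +_; -[1+_]; _⊖_; _◃_; sign; ∣_∣)
import Data.Integer.Properties as ℤ
open import Data.Sign as Sign using (Sign)
open import Data.Product using (_,_)
open import Data.Sum using (_⊎_; inj₁; inj₂; [_,_])
open import Data.Empty using (⊥-elim)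
open import Data.Maybe using (map)
open import Function using (_∘_)
open import Relation.Nullary using (¬_; yes; no; dec⇒maybe)
open import Relation.Binary.PropositionalEquality as ≡ using (_≡_; _≢_)
import Relation.Binary.Reasoning.Setoid as SetoidReasoning
open import Algebra.Bundles using (CommutativeRing; Ring)
import Algebra.Solver.Ring
import Algebra.Solver.Ring.AlmostCommutativeRing as ACR

backward-induction : ∀ {p} (Q : ℕ → Set p) K → (∀ n → n < K → (∀ l → suc n ≤ l → Q l) → Q n) →
  (∀ l → K ≤ l → Q l) → ∀ l → Q l
backward-induction Q zero    step Q≥K l = Q≥K l z≤n
backward-induction Q (suc K) step Q≥1+K = backward-induction Q K (λ n n<K → step n (ℕ.m≤n⇒m≤1+n n<K)) Q≥K
  where
  Q≥K : ∀ l → K ≤ l → Q l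
  Q≥K l K≤l with ℕ.m≤n⇒m<n∨m≡n K≤l
  ... | inj₁ K<l    = Q≥1+K l K<l
  ... | inj₂ ≡.refl = step K ℕ.≤-refl Q≥1+K

-- With coefficients in ℤ the solver also normalises cancellations such as a - a = 0.
module IntegerCoefficientSolver {c ℓ} (R : CommutativeRing c ℓ) where
  open CommutativeRing R
  open import Algebra.Properties.Semiring.Mult semiring using (_×_; ×-homo-+; ×1-homo-*)
  open import Algebra.Properties.Ring ring using (-1*x≈-x)
  open import Algebra.Properties.Group +-group using (⁻¹-involutive; ε⁻¹≈ε)
  open import Algebra.Properties.AbelianGroup +-abelianGroup using (⁻¹-∙-comm)
  open import Algebra.Properties.CommutativeSemigroup +-commutativeSemigroup using (x∙yz≈y∙xz)
  open import Algebra.Properties.CommutativeSemigroup *-commutativeSemigroup using (interchange)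
  open SetoidReasoning setoid

  fromℤ : ℤ → Carrier
  fromℤ (+ n)    = n × 1#
  fromℤ -[1+ n ] = - (suc n × 1#)

  fromSign : Sign → Carrier
  fromSign Sign.+ = 1#
  fromSign Sign.- = - 1#

  fromℤ-⊖+ : ∀ m n → fromℤ (m ⊖ n) + n × 1# ≈ m × 1#
  fromℤ-⊖+ m zero = begin
    fromℤ (m ⊖ 0) + 0#
      ≈⟨ +-identityʳ _ ⟩
    fromℤ (m ⊖ 0)
      ≈⟨ reflexive (≡.cong fromℤ (ℤ.⊖-≥ {m} {0} z≤n)) ⟩
    m × 1# ∎
  fromℤ-⊖+ zero (suc n) = -‿inverseˡ _
  fromℤ-⊖+ (suc m) (suc n) = begin
    fromℤ (suc m ⊖ suc n) + (1# + n × 1#)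
      ≈⟨ +-congʳ (reflexive (≡.cong fromℤ (ℤ.[1+m]⊖[1+n]≡m⊖n m n))) ⟩
    fromℤ (m ⊖ n) + (1# + n × 1#)
      ≈⟨ x∙yz≈y∙xz _ _ _ ⟩
    1# + (fromℤ (m ⊖ n) + n × 1#)
      ≈⟨ +-congˡ (fromℤ-⊖+ m n) ⟩
    1# + m × 1# ∎

  fromℤ-⊖ : ∀ m n → fromℤ (m ⊖ n) ≈ m × 1# - n × 1#
  fromℤ-⊖ m n = begin
    fromℤ (m ⊖ n)
      ≈⟨ sym (+-identityʳ _) ⟩
    fromℤ (m ⊖ n) + 0#
      ≈⟨ +-congˡ (sym (-‿inverseʳ _)) ⟩
    fromℤ (m ⊖ n) + (n × 1# - n × 1#)
      ≈⟨ sym (+-assoc _ _ _) ⟩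
    fromℤ (m ⊖ n) + n × 1# - n × 1#
      ≈⟨ +-congʳ (fromℤ-⊖+ m n) ⟩
    m × 1# - n × 1# ∎

  fromℤ-+ : ∀ x y → fromℤ (x ℤ.+ y) ≈ fromℤ x + fromℤ y
  fromℤ-+ (+ m)    (+ n)    = ×-homo-+ 1# m n
  fromℤ-+ (+ m)    -[1+ n ] = fromℤ-⊖ m (suc n)
  fromℤ-+ -[1+ m ] (+ n)    = trans (fromℤ-⊖ n (suc m)) (+-comm _ _)
  fromℤ-+ -[1+ m ] -[1+ n ] = begin
    - (suc (suc m ℕ.+ n) × 1#)
      ≈⟨ -‿cong (reflexive (≡.cong (λ k → suc k × 1#) (≡.sym (ℕ.+-suc m n)))) ⟩
    - ((suc m ℕ.+ suc n) × 1#)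
      ≈⟨ -‿cong (×-homo-+ 1# (suc m) (suc n)) ⟩
    - (suc m × 1# + suc n × 1#)
      ≈⟨ sym (⁻¹-∙-comm _ _) ⟩
    - (suc m × 1#) + - (suc n × 1#) ∎

  fromℤ-neg : ∀ x → fromℤ (ℤ.- x) ≈ - fromℤ x
  fromℤ-neg (+ zero)  = sym ε⁻¹≈ε
  fromℤ-neg (+ suc n) = refl
  fromℤ-neg -[1+ n ]  = sym (⁻¹-involutive _)

  fromSign-* : ∀ s t → fromSign (s Sign.* t) ≈ fromSign s * fromSign t
  fromSign-* Sign.+ t      = sym (*-identityˡ _)
  fromSign-* Sign.- Sign.+ = sym (*-identityʳ _)
  fromSign-* Sign.- Sign.- = sym (trans (-1*x≈-x (- 1#)) (⁻¹-involutive 1#))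

  fromℤ-◃ : ∀ s n → fromℤ (s ◃ n) ≈ fromSign s * (n × 1#)
  fromℤ-◃ s      zero    = sym (zeroʳ _)
  fromℤ-◃ Sign.+ (suc n) = sym (*-identityˡ _)
  fromℤ-◃ Sign.- (suc n) = sym (-1*x≈-x _)

  fromℤ-* : ∀ x y → fromℤ (x ℤ.* y) ≈ fromℤ x * fromℤ y
  fromℤ-* x y = begin
    fromℤ (sign x Sign.* sign y ◃ ∣ x ∣ ℕ.* ∣ y ∣)
      ≈⟨ fromℤ-◃ (sign x Sign.* sign y) (∣ x ∣ ℕ.* ∣ y ∣) ⟩
    fromSign (sign x Sign.* sign y) * ((∣ x ∣ ℕ.* ∣ y ∣) × 1#)
      ≈⟨ *-cong (fromSign-* (sign x) (sign y)) (×1-homo-* ∣ x ∣ ∣ y ∣) ⟩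
    (fromSign (sign x) * fromSign (sign y)) * ((∣ x ∣ × 1#) * (∣ y ∣ × 1#))
      ≈⟨ interchange _ _ _ _ ⟩
    (fromSign (sign x) * (∣ x ∣ × 1#)) * (fromSign (sign y) * (∣ y ∣ × 1#))
      ≈⟨ sym (*-cong (polar x) (polar y)) ⟩
    fromℤ x * fromℤ y ∎
    where
    polar : ∀ x → fromℤ x ≈ fromSign (sign x) * (∣ x ∣ × 1#)
    polar x = trans (reflexive (≡.cong fromℤ (≡.sym (ℤ.◃-inverse x)))) (fromℤ-◃ (sign x) ∣ x ∣)

  homomorphism : ℤ.+-*-rawRing ACR.-Raw-AlmostCommutative⟶ ACR.fromCommutativeRing R
  homomorphism = record
    { ⟦_⟧ = fromℤ ; +-homo = fromℤ-+ ; *-homo = fromℤ-* ; -‿homo = fromℤ-neg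
    ; 0-homo = refl ; 1-homo = +-identityʳ 1# }

  open Algebra.Solver.Ring ℤ.+-*-rawRing (ACR.fromCommutativeRing R) homomorphism
    (λ x y → map (reflexive ∘ ≡.cong fromℤ) (dec⇒maybe (x ℤ.≟ y)))
    public using (solve; _:=_; _:+_; _:*_; :-_; _:-_)

module _ {c ℓ} (F : Field c ℓ) where
  open Field F hiding (zero)
  open WithField F
  open IntegerCoefficientSolver commutativeRing using (solve; _:=_; _:+_; _:*_; :-_; _:-_)
  open import Algebra.Properties.Semiring.Mult semiring using (_×_; ×1-homo-*)
  open import Algebra.Properties.Group +-group using (ε⁻¹≈ε; ⁻¹-involutive; x∙y⁻¹≈ε⇒x≈y)
  open import Algebra.Properties.AbelianGroup +-abelianGroup using (⁻¹-∙-comm)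
  open import Algebra.Properties.CommutativeSemigroup +-commutativeSemigroup using (interchange)
  open import Algebra.Properties.CommutativeSemigroup *-commutativeSemigroup using () renaming (interchange to *-interchange)
  open import Algebra.Properties.RingWithoutOne (Ring.ringWithoutOne ring) using ([y-z]x≈yx-zx; x[y-z]≈xy-xz)
  open SetoidReasoning setoid

  sumTo-cong : ∀ n {f h : ℕ → Carrier} → (∀ k → k ≤ n → f k ≈ h k) → sumTo n f ≈ sumTo n h
  sumTo-cong zero    f≈h = f≈h 0 z≤n
  sumTo-cong (suc n) f≈h = +-cong (sumTo-cong n (λ k k≤n → f≈h k (ℕ.m≤n⇒m≤1+n k≤n))) (f≈h (suc n) ℕ.≤-refl)

  sumTo-≈0 : ∀ n {f : ℕ → Carrier} → (∀ k → k ≤ n → f k ≈ 0#) → sumTo n f ≈ 0#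
  sumTo-≈0 zero    f≈0 = f≈0 0 z≤n
  sumTo-≈0 (suc n) f≈0 =
    trans (+-cong (sumTo-≈0 n (λ k k≤n → f≈0 k (ℕ.m≤n⇒m≤1+n k≤n))) (f≈0 (suc n) ℕ.≤-refl)) (+-identityʳ 0#)

  sumTo-+ : ∀ n (f h : ℕ → Carrier) → sumTo n (λ k → f k + h k) ≈ sumTo n f + sumTo n h
  sumTo-+ zero    f h = refl
  sumTo-+ (suc n) f h = trans (+-congʳ (sumTo-+ n f h)) (interchange _ _ _ _)

  sumTo-neg : ∀ n (f : ℕ → Carrier) → sumTo n (λ k → - f k) ≈ - sumTo n f
  sumTo-neg zero    f = refl
  sumTo-neg (suc n) f = trans (+-congʳ (sumTo-neg n f)) (⁻¹-∙-comm _ _)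

  sumTo-− : ∀ n (f h : ℕ → Carrier) → sumTo n (λ k → f k - h k) ≈ sumTo n f - sumTo n h
  sumTo-− n f h = trans (sumTo-+ n f (λ k → - h k)) (+-congˡ (sumTo-neg n h))

  *-distribˡ-sumTo : ∀ n w (f : ℕ → Carrier) → w * sumTo n f ≈ sumTo n (λ k → w * f k)
  *-distribˡ-sumTo zero    w f = refl
  *-distribˡ-sumTo (suc n) w f = trans (distribˡ _ _ _) (+-congʳ (*-distribˡ-sumTo n w f))

  *-distribʳ-sumTo : ∀ n w (f : ℕ → Carrier) → sumTo n f * w ≈ sumTo n (λ k → f k * w)
  *-distribʳ-sumTo zero    w f = refl
  *-distribʳ-sumTo (suc n) w f = trans (distribʳ _ _ _) (+-congʳ (*-distribʳ-sumTo n w f))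

  sumTo-single : ∀ n k {f : ℕ → Carrier} → k ≤ n → (∀ l → l ≤ n → l ≢ k → f l ≈ 0#) → sumTo n f ≈ f k
  sumTo-single zero .zero z≤n f≈0 = refl
  sumTo-single (suc n) k k≤1+n f≈0 with k ≟ suc n
  ... | yes ≡.refl = trans (+-congʳ (sumTo-≈0 n (λ l l≤n → f≈0 l (ℕ.m≤n⇒m≤1+n l≤n) (ℕ.<⇒≢ (s≤s l≤n)))))
                           (+-identityˡ _)
  ... | no k≢1+n   = trans (+-cong (sumTo-single n k (ℕ.≤-pred (ℕ.≤∧≢⇒< k≤1+n k≢1+n))
                                      (λ l l≤n → f≈0 l (ℕ.m≤n⇒m≤1+n l≤n)))
                                   (f≈0 (suc n) ℕ.≤-refl (k≢1+n ∘ ≡.sym)))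
                           (+-identityʳ _)

  sumTo-swap : ∀ m n (G : ℕ → ℕ → Carrier) →
    sumTo m (λ i → sumTo n (G i)) ≈ sumTo n (λ j → sumTo m (λ i → G i j))
  sumTo-swap zero    n G = refl
  sumTo-swap (suc m) n G = trans (+-congʳ (sumTo-swap m n G)) (sym (sumTo-+ n _ (G (suc m))))

  sumTo-suc : ∀ n (f : ℕ → Carrier) → sumTo (suc n) f ≈ f 0 + sumTo n (f ∘ suc)
  sumTo-suc zero    f = refl
  sumTo-suc (suc n) f = trans (+-congʳ (sumTo-suc n f)) (+-assoc _ _ _)

  sumTo-extend : ∀ n m {f : ℕ → Carrier} → n ≤ m → (∀ k → n < k → f k ≈ 0#) → sumTo m f ≈ sumTo n f
  sumTo-extend n zero    z≤n  f≈0 = refl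
  sumTo-extend n (suc m) n≤1+m f≈0 with ℕ.m≤n⇒m<n∨m≡n n≤1+m
  ... | inj₂ ≡.refl = refl
  ... | inj₁ n<1+m  = trans (+-cong (sumTo-extend n m (ℕ.≤-pred n<1+m) f≈0) (f≈0 (suc m) n<1+m)) (+-identityʳ _)

  sumTo²-single : ∀ A B a b {G : ℕ → ℕ → Carrier} → a ≤ A → b ≤ B →
    (∀ a' b' → a' ≤ A → b' ≤ B → a' ≢ a ⊎ b' ≢ b → G a' b' ≈ 0#) →
    sumTo A (λ a' → sumTo B (G a')) ≈ G a b
  sumTo²-single A B a b a≤A b≤B G≈0 =
    trans (sumTo-single A a a≤A (λ a' a'≤A a'≢a → sumTo-≈0 B (λ b' b'≤B → G≈0 a' b' a'≤A b'≤B (inj₁ a'≢a))))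
          (sumTo-single B b b≤B (λ b' b'≤B b'≢b → G≈0 a b' a≤A b'≤B (inj₂ b'≢b)))

  sumTo²-≈0 : ∀ A B {G : ℕ → ℕ → Carrier} → (∀ a b → a ≤ A → b ≤ B → G a b ≈ 0#) →
    sumTo A (λ a → sumTo B (G a)) ≈ 0#
  sumTo²-≈0 A B G≈0 = sumTo-≈0 A (λ a a≤A → sumTo-≈0 B (λ b b≤B → G≈0 a b a≤A b≤B))

  sumTo-swap₃ : ∀ A C D (G : ℕ → ℕ → ℕ → Carrier) →
    sumTo A (λ i → sumTo C (λ m → sumTo D (G i m))) ≈ sumTo C (λ m → sumTo D (λ n → sumTo A (λ i → G i m n)))
  sumTo-swap₃ A C D G = trans (sumTo-swap A C _) (sumTo-cong C (λ m _ → sumTo-swap A D _))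

  -- Backward differences of univariate coefficient sequences

  δ-refl : ∀ m → δ m m ≈ 1#
  δ-refl m with m ≟ m
  ... | yes _   = refl
  ... | no m≢m = ⊥-elim (m≢m ≡.refl)

  δ-≢ : ∀ {m i} → m ≢ i → δ m i ≈ 0#
  δ-≢ {m} {i} m≢i with m ≟ i
  ... | yes m≡i = ⊥-elim (m≢i m≡i)
  ... | no _    = refl

  -- [u-1]^-coeff l k is the coefficient of u^k in (u - 1)^l.
  [u-1]^-coeff : ℕ → ℕ → Carrier
  [u-1]^-coeff zero    zero    = 1#
  [u-1]^-coeff zero    (suc k) = 0#
  [u-1]^-coeff (suc l) zero    = - [u-1]^-coeff l 0
  [u-1]^-coeff (suc l) (suc k) = [u-1]^-coeff l k - [u-1]^-coeff l (suc k)

  [u-1]^-coeff-< : ∀ {l k} → l < k → [u-1]^-coeff l k ≈ 0#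
  [u-1]^-coeff-< {zero}  {suc k} _         = refl
  [u-1]^-coeff-< {suc l} {suc k} (s≤s l<k) =
    trans (+-cong ([u-1]^-coeff-< l<k) (-‿cong ([u-1]^-coeff-< (ℕ.m≤n⇒m≤1+n l<k)))) (-‿inverseʳ 0#)

  [u-1]^-coeff-diag : ∀ l → [u-1]^-coeff l l ≈ 1#
  [u-1]^-coeff-diag zero    = refl
  [u-1]^-coeff-diag (suc l) =
    trans (+-cong ([u-1]^-coeff-diag l) (trans (-‿cong ([u-1]^-coeff-< (ℕ.n<1+n l))) ε⁻¹≈ε)) (+-identityʳ 1#)

  [u-1]^-coeff-subdiag : ∀ l → [u-1]^-coeff (suc l) l ≈ - fromℕ (suc l)
  [u-1]^-coeff-subdiag zero    = -‿cong (sym (+-identityʳ 1#))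
  [u-1]^-coeff-subdiag (suc l) = begin
    [u-1]^-coeff (suc l) l - [u-1]^-coeff (suc l) (suc l)
      ≈⟨ +-cong ([u-1]^-coeff-subdiag l) (-‿cong ([u-1]^-coeff-diag (suc l))) ⟩
    - fromℕ (suc l) - 1#
      ≈⟨ solve 2 (λ n o → :- n :- o := :- (o :+ n)) refl (fromℕ (suc l)) 1# ⟩
    - (1# + fromℕ (suc l)) ∎

  pow-as-sum : ∀ N l u → l ≤ N → u ^ l ≈ sumTo N (λ k → δ l k * u ^ k)
  pow-as-sum N l u l≤N = sym (trans
    (sumTo-single N l l≤N (λ k _ k≢l → trans (*-congʳ (δ-≢ (k≢l ∘ ≡.sym))) (zeroˡ _)))
    (trans (*-congʳ (δ-refl l)) (*-identityˡ _)))

  [u-1]^-expand : ∀ N l u → l ≤ N → (u - 1#) ^ l ≈ sumTo N (λ k → [u-1]^-coeff l k * u ^ k)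
  [u-1]^-expand N zero u _ = sym (trans
    (sumTo-single N 0 z≤n (λ { (suc k) _ _ → zeroˡ _ ; zero _ 0≢0 → ⊥-elim (0≢0 ≡.refl) }))
    (*-identityˡ _))
  [u-1]^-expand (suc N) (suc l) u (s≤s l≤N) = sym (begin
    sumTo (suc N) (λ k → b (suc l) k * u ^ k)
      ≈⟨ sumTo-suc N _ ⟩
    - b l 0 * 1# + sumTo N (λ k → (b l k - b l (suc k)) * (u * u ^ k))
      ≈⟨ +-congˡ shifted ⟩
    - b l 0 * 1# + (u * X - Y)
      ≈⟨ solve 4 (λ z o p y → :- z :* o :+ (p :- y) := p :- (z :* o :+ y))
          refl (b l 0) 1# (u * X) Y ⟩
    u * X - (b l 0 * 1# + Y)
      ≈⟨ +-congˡ (-‿cong (sym X≈b₀+Y)) ⟩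
    u * X - X
      ≈⟨ +-congˡ (-‿cong (sym (*-identityˡ X))) ⟩
    u * X - 1# * X
      ≈⟨ sym ([y-z]x≈yx-zx X u 1#) ⟩
    (u - 1#) * X
      ≈⟨ *-congˡ (sym ([u-1]^-expand N l u l≤N)) ⟩
    (u - 1#) * (u - 1#) ^ l ∎)
    where
    b = [u-1]^-coeff
    X Y : Carrier
    X = sumTo N (λ k → b l k * u ^ k)
    Y = sumTo N (λ k → b l (suc k) * u ^ suc k)
    X≈b₀+Y : X ≈ b l 0 * 1# + Y
    X≈b₀+Y = trans (sym (trans (+-congˡ (trans (*-congʳ ([u-1]^-coeff-< (s≤s l≤N))) (zeroˡ _))) (+-identityʳ _)))
                   (sumTo-suc N _)
    shifted : sumTo N (λ k → (b l k - b l (suc k)) * (u * u ^ k)) ≈ u * X - Y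
    shifted = begin
      sumTo N (λ k → (b l k - b l (suc k)) * (u * u ^ k))
        ≈⟨ sumTo-cong N (λ k _ → solve 4
            (λ x y u p → (x :- y) :* (u :* p) := u :* (x :* p) :- y :* (u :* p))
            refl (b l k) (b l (suc k)) u (u ^ k)) ⟩
      sumTo N (λ k → u * (b l k * u ^ k) - b l (suc k) * u ^ suc k)
        ≈⟨ sumTo-− N _ _ ⟩
      sumTo N (λ k → u * (b l k * u ^ k)) - Y
        ≈⟨ +-congʳ (sym (*-distribˡ-sumTo N u _)) ⟩
      u * X - Y ∎

  eval₁ : ℕ → (ℕ → Carrier) → Carrier → Carrier
  eval₁ N c u = sumTo N (λ i → c i * u ^ i)

  Δcoeff : ℕ → ℕ → Carrier
  Δcoeff l k = δ l k - [u-1]^-coeff l k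

  Δᶜ : ℕ → (ℕ → Carrier) → (ℕ → Carrier)
  Δᶜ N c k = sumTo N (λ l → c l * Δcoeff l k)

  eval₁-Δᶜ : ∀ N c u → eval₁ N c u - eval₁ N c (u - 1#) ≈ eval₁ N (Δᶜ N c) u
  eval₁-Δᶜ N c u = begin
    eval₁ N c u - eval₁ N c (u - 1#)
      ≈⟨ sym (sumTo-− N _ _) ⟩
    sumTo N (λ l → c l * u ^ l - c l * (u - 1#) ^ l)
      ≈⟨ sumTo-cong N expand ⟩
    sumTo N (λ l → sumTo N (λ k → (c l * Δcoeff l k) * u ^ k))
      ≈⟨ sumTo-swap N N _ ⟩
    sumTo N (λ k → sumTo N (λ l → (c l * Δcoeff l k) * u ^ k))
      ≈⟨ sumTo-cong N (λ k _ → sym (*-distribʳ-sumTo N _ _)) ⟩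
    eval₁ N (Δᶜ N c) u ∎
    where
    expand : ∀ l → l ≤ N → c l * u ^ l - c l * (u - 1#) ^ l ≈ sumTo N (λ k → (c l * Δcoeff l k) * u ^ k)
    expand l l≤N = begin
      c l * u ^ l - c l * (u - 1#) ^ l
        ≈⟨ +-cong (*-congˡ (pow-as-sum N l u l≤N)) (-‿cong (*-congˡ ([u-1]^-expand N l u l≤N))) ⟩
      c l * sumTo N (λ k → δ l k * u ^ k) - c l * sumTo N (λ k → [u-1]^-coeff l k * u ^ k)
        ≈⟨ +-cong (*-distribˡ-sumTo N _ _) (-‿cong (*-distribˡ-sumTo N _ _)) ⟩
      sumTo N (λ k → c l * (δ l k * u ^ k)) - sumTo N (λ k → c l * ([u-1]^-coeff l k * u ^ k))
        ≈⟨ sym (sumTo-− N _ _) ⟩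
      sumTo N (λ k → c l * (δ l k * u ^ k) - c l * ([u-1]^-coeff l k * u ^ k))
        ≈⟨ sumTo-cong N (λ k _ → solve 4 (λ a d b p → a :* (d :* p) :- a :* (b :* p) := (a :* (d :- b)) :* p)
            refl (c l) (δ l k) ([u-1]^-coeff l k) (u ^ k)) ⟩
      sumTo N (λ k → (c l * Δcoeff l k) * u ^ k) ∎

  DegreeBelow : ℕ → (ℕ → Carrier) → Set ℓ
  DegreeBelow k c = ∀ l → k ≤ l → c l ≈ 0#

  Δcoeff-≤ : ∀ {l k} → l ≤ k → Δcoeff l k ≈ 0#
  Δcoeff-≤ {l} {k} l≤k with ℕ.m≤n⇒m<n∨m≡n l≤k
  ... | inj₂ ≡.refl = trans (+-cong (δ-refl l) (-‿cong ([u-1]^-coeff-diag l))) (-‿inverseʳ 1#)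
  ... | inj₁ l<k    = trans (+-cong (δ-≢ (ℕ.<⇒≢ l<k)) (-‿cong ([u-1]^-coeff-< l<k))) (-‿inverseʳ 0#)

  Δᶜ-cong : ∀ N {c c′ : ℕ → Carrier} → (∀ l → c l ≈ c′ l) → ∀ k → Δᶜ N c k ≈ Δᶜ N c′ k
  Δᶜ-cong N c≈c′ k = sumTo-cong N (λ l _ → *-congʳ (c≈c′ l))

  Δᶜ-degree : ∀ N k {c} → DegreeBelow k c → DegreeBelow (ℕ.pred k) (Δᶜ N c)
  Δᶜ-degree N k {c} deg k′ pred-k≤k′ = sumTo-≈0 N term
    where
    term : ∀ l → l ≤ N → c l * Δcoeff l k′ ≈ 0#
    term l _ with k ≤? l
    ... | yes k≤l = trans (*-congʳ (deg l k≤l)) (zeroˡ _)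
    ... | no  k≰l = trans (*-congˡ (Δcoeff-≤ (ℕ.≤-trans (ℕ.suc[m]≤n⇒m≤pred[n] (ℕ.≰⇒> k≰l)) pred-k≤k′))) (zeroʳ _)

  Δᶜ-leading : ∀ N m {c} → DegreeBelow (2 ℕ.+ m) c → suc m ≤ N → Δᶜ N c m ≈ fromℕ (suc m) * c (suc m)
  Δᶜ-leading N m {c} deg 1+m≤N = begin
    Δᶜ N c m
      ≈⟨ sumTo-single N (suc m) 1+m≤N other ⟩
    c (suc m) * (δ (suc m) m - [u-1]^-coeff (suc m) m)
      ≈⟨ *-congˡ (+-cong (δ-≢ (ℕ.<⇒≢ (ℕ.n<1+n m) ∘ ≡.sym)) (-‿cong ([u-1]^-coeff-subdiag m))) ⟩
    c (suc m) * (0# - - fromℕ (suc m))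
      ≈⟨ *-congˡ (trans (+-identityˡ _) (⁻¹-involutive _)) ⟩
    c (suc m) * fromℕ (suc m)
      ≈⟨ *-comm _ _ ⟩
    fromℕ (suc m) * c (suc m) ∎
    where
    other : ∀ l → l ≤ N → l ≢ suc m → c l * Δcoeff l m ≈ 0#
    other l _ l≢1+m with 2 ℕ.+ m ≤? l
    ... | yes 2+m≤l = trans (*-congʳ (deg l 2+m≤l)) (zeroˡ _)
    ... | no  2+m≰l = trans (*-congˡ (Δcoeff-≤ (ℕ.≤-pred (ℕ.≤∧≢⇒< (ℕ.≤-pred (ℕ.≰⇒> 2+m≰l)) l≢1+m)))) (zeroʳ _)

  fromℕ≡×1# : ∀ n → fromℕ n ≡ n × 1#
  fromℕ≡×1# zero    = ≡.refl
  fromℕ≡×1# (suc n) = ≡.cong (λ x → 1# + x) (fromℕ≡×1# n)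

  fromℕ-* : ∀ m n → fromℕ (m ℕ.* n) ≈ fromℕ m * fromℕ n
  fromℕ-* m n rewrite fromℕ≡×1# (m ℕ.* n) | fromℕ≡×1# m | fromℕ≡×1# n = ×1-homo-* m n

  fromℕ-!-suc : ∀ k → fromℕ (suc k !) ≈ fromℕ (k !) * fromℕ (suc k)
  fromℕ-!-suc k = trans (fromℕ-* (suc k) (k !)) (*-comm _ _)

  iter-suc : ∀ {A : Set c} (f : A → A) k a → iter f (suc k) a ≡ iter f k (f a)
  iter-suc f zero    a = ≡.refl
  iter-suc f (suc k) a = ≡.cong f (iter-suc f k a)

  iter-Δᶜ-degree : ∀ N i k {c} → DegreeBelow k c → DegreeBelow (k ∸ i) (iter (Δᶜ N) i c)
  iter-Δᶜ-degree N zero    k deg = deg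
  iter-Δᶜ-degree N (suc i) k deg rewrite ≡.sym (ℕ.pred[m∸n]≡m∸[1+n] k i) =
    Δᶜ-degree N (k ∸ i) (iter-Δᶜ-degree N i k deg)

  iter-Δᶜ-leading : ∀ N m {c} → DegreeBelow (suc m) c → m ≤ N → iter (Δᶜ N) m c 0 ≈ fromℕ (m !) * c m
  iter-Δᶜ-leading N zero    deg _     = sym (trans (*-congʳ (+-identityʳ 1#)) (*-identityˡ _))
  iter-Δᶜ-leading N (suc m) {c} deg 1+m≤N = begin
    iter (Δᶜ N) (suc m) c 0
      ≡⟨ ≡.cong (λ f → f 0) (iter-suc (Δᶜ N) m c) ⟩
    iter (Δᶜ N) m (Δᶜ N c) 0
      ≈⟨ iter-Δᶜ-leading N m (Δᶜ-degree N (2 ℕ.+ m) deg) (ℕ.<⇒≤ 1+m≤N) ⟩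
    fromℕ (m !) * Δᶜ N c m
      ≈⟨ *-congˡ (Δᶜ-leading N m deg 1+m≤N) ⟩
    fromℕ (m !) * (fromℕ (suc m) * c (suc m))
      ≈⟨ sym (*-assoc _ _ _) ⟩
    fromℕ (m !) * fromℕ (suc m) * c (suc m)
      ≈⟨ *-congʳ (sym (fromℕ-!-suc m)) ⟩
    fromℕ (suc m !) * c (suc m) ∎

  eval₁-constant : ∀ N {c} v → DegreeBelow 1 c → eval₁ N c v ≈ c 0
  eval₁-constant N v deg = trans
    (sumTo-single N 0 z≤n (λ { zero _ 0≢0 → ⊥-elim (0≢0 ≡.refl)
                             ; (suc l) _ _ → trans (*-congʳ (deg (suc l) (s≤s z≤n))) (zeroˡ _) }))
    (*-identityʳ _)

  -- Backward differences of bivariate polynomials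

  Δᶜx : ℕ → Pol → Pol
  Δᶜx A W i j = Δᶜ A (λ l → W l j) i

  Δᶜy : ℕ → Pol → Pol
  Δᶜy B W i = Δᶜ B (W i)

  evalΠ-by-rows : ∀ A B W u v → evalΠ A B W u v ≈ sumTo A (λ i → eval₁ B (W i) v * u ^ i)
  evalΠ-by-rows A B W u v = sumTo-cong A (λ i _ → trans
    (sumTo-cong B (λ j _ → solve 3 (λ w p q → w :* (p :* q) := (w :* q) :* p) refl (W i j) (u ^ i) (v ^ j)))
    (sym (*-distribʳ-sumTo B (u ^ i) _)))

  evalΠ-by-columns : ∀ A B W u v → evalΠ A B W u v ≈ sumTo B (λ j → eval₁ A (λ i → W i j) u * v ^ j)
  evalΠ-by-columns A B W u v = trans (sumTo-swap A B _) (sumTo-cong B (λ j _ → trans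
    (sumTo-cong A (λ i _ → solve 3 (λ w p q → w :* (p :* q) := (w :* p) :* q) refl (W i j) (u ^ i) (v ^ j)))
    (sym (*-distribʳ-sumTo A (v ^ j) _))))

  Δx-evalΠ : ∀ A B W u v → Δx (evalΠ A B W) u v ≈ evalΠ A B (Δᶜx A W) u v
  Δx-evalΠ A B W u v = begin
    evalΠ A B W u v - evalΠ A B W (u - 1#) v
      ≈⟨ +-cong (evalΠ-by-columns A B W u v) (-‿cong (evalΠ-by-columns A B W (u - 1#) v)) ⟩
    sumTo B (λ j → eval₁ A (column j) u * v ^ j) - sumTo B (λ j → eval₁ A (column j) (u - 1#) * v ^ j)
      ≈⟨ sym (sumTo-− B _ _) ⟩
    sumTo B (λ j → eval₁ A (column j) u * v ^ j - eval₁ A (column j) (u - 1#) * v ^ j)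
      ≈⟨ sumTo-cong B (λ j _ → trans (sym ([y-z]x≈yx-zx _ _ _)) (*-congʳ (eval₁-Δᶜ A (column j) u))) ⟩
    sumTo B (λ j → eval₁ A (λ i → Δᶜx A W i j) u * v ^ j)
      ≈⟨ sym (evalΠ-by-columns A B (Δᶜx A W) u v) ⟩
    evalΠ A B (Δᶜx A W) u v ∎
    where
    column : ℕ → ℕ → Carrier
    column j i = W i j

  Δy-evalΠ : ∀ A B W u v → Δy (evalΠ A B W) u v ≈ evalΠ A B (Δᶜy B W) u v
  Δy-evalΠ A B W u v = begin
    evalΠ A B W u v - evalΠ A B W u (v - 1#)
      ≈⟨ +-cong (evalΠ-by-rows A B W u v) (-‿cong (evalΠ-by-rows A B W u (v - 1#))) ⟩
    sumTo A (λ i → eval₁ B (W i) v * u ^ i) - sumTo A (λ i → eval₁ B (W i) (v - 1#) * u ^ i)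
      ≈⟨ sym (sumTo-− A _ _) ⟩
    sumTo A (λ i → eval₁ B (W i) v * u ^ i - eval₁ B (W i) (v - 1#) * u ^ i)
      ≈⟨ sumTo-cong A (λ i _ → trans (sym ([y-z]x≈yx-zx _ _ _)) (*-congʳ (eval₁-Δᶜ B (W i) v))) ⟩
    sumTo A (λ i → eval₁ B (Δᶜy B W i) v * u ^ i)
      ≈⟨ sym (evalΠ-by-rows A B (Δᶜy B W) u v) ⟩
    evalΠ A B (Δᶜy B W) u v ∎

  Fn : Set c
  Fn = Carrier → Carrier → Carrier

  infix 4 _≈ᶠ_
  _≈ᶠ_ : Fn → Fn → Set (c ⊔ ℓ)
  f ≈ᶠ h = ∀ u v → f u v ≈ h u v

  -- Δx and Δy are both instances of ∇, and unfold to it definitionally.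
  module Difference (s t : Carrier → Carrier → Carrier) where

    ∇ : Fn → Fn
    ∇ f u v = f u v - f (s u v) (t u v)

    iter-∇-cong : ∀ i {f h} → f ≈ᶠ h → iter ∇ i f ≈ᶠ iter ∇ i h
    iter-∇-cong zero    f≈h = f≈h
    iter-∇-cong (suc i) f≈h u v = +-cong (iter-∇-cong i f≈h u v) (-‿cong (iter-∇-cong i f≈h (s u v) (t u v)))

    iter-∇-− : ∀ i f h → iter ∇ i (λ u v → f u v - h u v) ≈ᶠ (λ u v → iter ∇ i f u v - iter ∇ i h u v)
    iter-∇-− zero    f h u v = refl
    iter-∇-− (suc i) f h u v = trans (iter-∇-cong 1 (iter-∇-− i f h) u v)
      (solve 4 (λ a b c d → (a :- b) :- (c :- d) := (a :- c) :- (b :- d)) refl _ _ _ _)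

    iter-∇-sumTo² : ∀ i A B (κ : ℕ → ℕ → Carrier) (E : ℕ → ℕ → Fn) →
      iter ∇ i (λ u v → sumTo A (λ m → sumTo B (λ n → κ m n * E m n u v)))
        ≈ᶠ (λ u v → sumTo A (λ m → sumTo B (λ n → κ m n * iter ∇ i (E m n) u v)))
    iter-∇-sumTo² zero    A B κ E u v = refl
    iter-∇-sumTo² (suc i) A B κ E u v = trans (iter-∇-cong 1 (iter-∇-sumTo² i A B κ E) u v) (begin
      sumTo A (λ m → sumTo B (λ n → κ m n * Eⁱ m n u v)) - sumTo A (λ m → sumTo B (λ n → κ m n * Eⁱ m n (s u v) (t u v)))
        ≈⟨ sym (sumTo-− A _ _) ⟩
      sumTo A (λ m → sumTo B (λ n → κ m n * Eⁱ m n u v) - sumTo B (λ n → κ m n * Eⁱ m n (s u v) (t u v)))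
        ≈⟨ sumTo-cong A (λ m _ → trans (sym (sumTo-− B _ _)) (sumTo-cong B (λ n _ → sym (x[y-z]≈xy-xz _ _ _)))) ⟩
      sumTo A (λ m → sumTo B (λ n → κ m n * iter ∇ (suc i) (E m n) u v)) ∎)
      where
      Eⁱ : ℕ → ℕ → Fn
      Eⁱ m n = iter ∇ i (E m n)

  open Difference (λ u v → u - 1#) (λ u v → v) public using ()
    renaming (iter-∇-cong to iter-Δx-cong; iter-∇-− to iter-Δx-−; iter-∇-sumTo² to iter-Δx-sumTo²)
  open Difference (λ u v → u) (λ u v → v - 1#) public using ()
    renaming (iter-∇-cong to iter-Δy-cong; iter-∇-− to iter-Δy-−; iter-∇-sumTo² to iter-Δy-sumTo²)

  iterΔxΔy-evalΠ : ∀ A B i j W → iter Δx i (iter Δy j (evalΠ A B W)) ≈ᶠ evalΠ A B (iter (Δᶜx A) i (iter (Δᶜy B) j W))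
  iterΔxΔy-evalΠ A B i j W = λ u v → trans (iter-Δx-cong i (Δy-part j) u v) (Δx-part i _ u v)
    where
    Δy-part : ∀ j → iter Δy j (evalΠ A B W) ≈ᶠ evalΠ A B (iter (Δᶜy B) j W)
    Δy-part zero    u v = refl
    Δy-part (suc j) u v = trans (iter-Δy-cong 1 (Δy-part j) u v) (Δy-evalΠ A B (iter (Δᶜy B) j W) u v)
    Δx-part : ∀ i V → iter Δx i (evalΠ A B V) ≈ᶠ evalΠ A B (iter (Δᶜx A) i V)
    Δx-part zero    V u v = refl
    Δx-part (suc i) V u v = trans (iter-Δx-cong 1 (Δx-part i V) u v) (Δx-evalΠ A B (iter (Δᶜx A) i V) u v)

  ∇₁ : (Carrier → Carrier) → (Carrier → Carrier)
  ∇₁ h v = h v - h (v - 1#)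

  iter-Δx-product : ∀ i (U V : Carrier → Carrier) → iter Δx i (λ u v → U u * V v) ≈ᶠ (λ u v → iter ∇₁ i U u * V v)
  iter-Δx-product zero    U V u v = refl
  iter-Δx-product (suc i) U V u v =
    trans (iter-Δx-cong 1 (iter-Δx-product i U V) u v) (sym ([y-z]x≈yx-zx _ _ _))

  iter-Δy-product : ∀ j (U V : Carrier → Carrier) → iter Δy j (λ u v → U u * V v) ≈ᶠ (λ u v → U u * iter ∇₁ j V v)
  iter-Δy-product zero    U V u v = refl
  iter-Δy-product (suc j) U V u v =
    trans (iter-Δy-cong 1 (iter-Δy-product j U V) u v) (sym (x[y-z]≈xy-xz _ _ _))

  iter-Δᶜx-column : ∀ A i W k j → iter (Δᶜx A) i W k j ≈ iter (Δᶜ A) i (λ l → W l j) k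
  iter-Δᶜx-column A zero    W k j = refl
  iter-Δᶜx-column A (suc i) W k j = Δᶜ-cong A (λ l → iter-Δᶜx-column A i W l j) k

  iter-Δᶜy-row : ∀ B j W i l → iter (Δᶜy B) j W i l ≈ iter (Δᶜ B) j (W i) l
  iter-Δᶜy-row B zero    W i l = refl
  iter-Δᶜy-row B (suc j) W i l = Δᶜ-cong B (λ l′ → iter-Δᶜy-row B j W i l′) l

  iter-Δᶜ-≈0 : ∀ N i {c} → (∀ l → c l ≈ 0#) → ∀ l → iter (Δᶜ N) i c l ≈ 0#
  iter-Δᶜ-≈0 N i {c} c≈0 l =
    ≡.subst (λ k → DegreeBelow k (iter (Δᶜ N) i c)) (ℕ.0∸n≡0 i) (iter-Δᶜ-degree N i 0 (λ l _ → c≈0 l)) l z≤n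

  XDegreeBelow : ℕ → Pol → Set ℓ
  XDegreeBelow k W = ∀ i j → k ≤ i → W i j ≈ 0#

  YDegreeBelow : ℕ → Pol → Set ℓ
  YDegreeBelow k W = ∀ i j → k ≤ j → W i j ≈ 0#

  iter-Δᶜx-XDegree : ∀ A i k {W} → XDegreeBelow k W → XDegreeBelow (k ∸ i) (iter (Δᶜx A) i W)
  iter-Δᶜx-XDegree A i k deg l j k∸i≤l =
    trans (iter-Δᶜx-column A i _ l j) (iter-Δᶜ-degree A i k (λ l′ → deg l′ j) l k∸i≤l)

  iter-Δᶜy-YDegree : ∀ B j k {W} → YDegreeBelow k W → YDegreeBelow (k ∸ j) (iter (Δᶜy B) j W)
  iter-Δᶜy-YDegree B j k deg i l k∸j≤l =
    trans (iter-Δᶜy-row B j _ i l) (iter-Δᶜ-degree B j k (deg i) l k∸j≤l)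

  iter-Δᶜx-YDegree : ∀ A i k {W} → YDegreeBelow k W → YDegreeBelow k (iter (Δᶜx A) i W)
  iter-Δᶜx-YDegree A i k deg l j k≤j =
    trans (iter-Δᶜx-column A i _ l j) (iter-Δᶜ-≈0 A i (λ l′ → deg l′ j k≤j) l)

  iter-Δᶜy-XDegree : ∀ B j k {W} → XDegreeBelow k W → XDegreeBelow k (iter (Δᶜy B) j W)
  iter-Δᶜy-XDegree B j k deg i l k≤i =
    trans (iter-Δᶜy-row B j _ i l) (iter-Δᶜ-≈0 B j (λ l′ → deg i l′ k≤i) l)

  ∸≢0 : ∀ {a i} → a ≤ i → a ≢ i → i ∸ a ≢ 0
  ∸≢0 a≤i a≢i = ℕ.m>n⇒m∸n≢0 (ℕ.≤∧≢⇒< a≤i a≢i)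

  ∸≢0⊎∸≢0 : ∀ {a b i j} → a ≤ i → b ≤ j → a ≢ i ⊎ b ≢ j → i ∸ a ≢ 0 ⊎ j ∸ b ≢ 0
  ∸≢0⊎∸≢0 a≤i _   (inj₁ a≢i) = inj₁ (∸≢0 a≤i a≢i)
  ∸≢0⊎∸≢0 _   b≤j (inj₂ b≢j) = inj₂ (∸≢0 b≤j b≢j)

  constᴾ-≈0 : ∀ w {i j} → i ≢ 0 ⊎ j ≢ 0 → constᴾ w i j ≈ 0#
  constᴾ-≈0 w {zero}  {zero}  (inj₁ 0≢0) = ⊥-elim (0≢0 ≡.refl)
  constᴾ-≈0 w {zero}  {zero}  (inj₂ 0≢0) = ⊥-elim (0≢0 ≡.refl)
  constᴾ-≈0 w {zero}  {suc j} _          = refl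
  constᴾ-≈0 w {suc i} {j}     _          = refl

  *ᴾ-cong : ∀ {p p′ q q′} → p ≈ᴾ p′ → q ≈ᴾ q′ → (p *ᴾ q) ≈ᴾ (p′ *ᴾ q′)
  *ᴾ-cong p≈p′ q≈q′ i j = sumTo-cong i (λ a _ → sumTo-cong j (λ b _ → *-cong (p≈p′ a b) (q≈q′ (i ∸ a) (j ∸ b))))

  *ᴾ-congˡ : ∀ p {q q′} → q ≈ᴾ q′ → (p *ᴾ q) ≈ᴾ (p *ᴾ q′)
  *ᴾ-congˡ p q≈q′ = *ᴾ-cong {p} (λ _ _ → refl) q≈q′

  *ᴾ-congʳ : ∀ q {p p′} → p ≈ᴾ p′ → (p *ᴾ q) ≈ᴾ (p′ *ᴾ q)
  *ᴾ-congʳ q p≈p′ = *ᴾ-cong {q = q} p≈p′ (λ _ _ → refl)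

  *ᴾ-constᴾ : ∀ p w i j → (p *ᴾ constᴾ w) i j ≈ p i j * w
  *ᴾ-constᴾ p w i j = trans
    (sumTo²-single i j i j ℕ.≤-refl ℕ.≤-refl (λ a b a≤i b≤j off →
      trans (*-congˡ (constᴾ-≈0 w (∸≢0⊎∸≢0 a≤i b≤j off))) (zeroʳ _)))
    (*-congˡ (reflexive (≡.cong₂ (constᴾ w) (ℕ.n∸n≡0 i) (ℕ.n∸n≡0 j))))

  constᴾ-*ᴾ : ∀ w q i j → (constᴾ w *ᴾ q) i j ≈ w * q i j
  constᴾ-*ᴾ w q i j = sumTo²-single i j 0 0 z≤n z≤n (λ a b _ _ off → trans (*-congʳ (constᴾ-≈0 w off)) (zeroˡ _))

  *-constᴾ : ∀ v w i j → v * constᴾ w i j ≈ constᴾ (v * w) i j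
  *-constᴾ v w zero    zero    = refl
  *-constᴾ v w zero    (suc j) = zeroʳ v
  *-constᴾ v w (suc i) j       = zeroʳ v

  constᴾ-*ᴾ-constᴾ : ∀ v w → (constᴾ v *ᴾ constᴾ w) ≈ᴾ constᴾ (v * w)
  constᴾ-*ᴾ-constᴾ v w i j = trans (constᴾ-*ᴾ v (constᴾ w) i j) (*-constᴾ v w i j)

  constᴾ-+ᴾ-constᴾ : ∀ v w → (constᴾ v +ᴾ constᴾ w) ≈ᴾ constᴾ (v + w)
  constᴾ-+ᴾ-constᴾ v w zero    zero    = refl
  constᴾ-+ᴾ-constᴾ v w zero    (suc j) = +-identityʳ 0#
  constᴾ-+ᴾ-constᴾ v w (suc i) j       = +-identityʳ 0#

  XOnly : Pol → Set ℓ
  XOnly p = ∀ i j → p i (suc j) ≈ 0#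

  YOnly : Pol → Set ℓ
  YOnly q = ∀ i j → q (suc i) j ≈ 0#

  *ᴾ-XOnlyʳ : ∀ p q → XOnly q → ∀ i j → (p *ᴾ q) i j ≈ sumTo i (λ a → p a j * q (i ∸ a) 0)
  *ᴾ-XOnlyʳ p q xq i j = sumTo-cong i (λ a _ → trans (sumTo-single j j ℕ.≤-refl off)
    (*-congˡ (reflexive (≡.cong (q (i ∸ a)) (ℕ.n∸n≡0 j)))))
    where
    off : ∀ {a} b → b ≤ j → b ≢ j → p a b * q (i ∸ a) (j ∸ b) ≈ 0#
    off b b≤j b≢j with j ∸ b | ∸≢0 b≤j b≢j
    ... | zero  | j∸b≢0 = ⊥-elim (j∸b≢0 ≡.refl)
    ... | suc t | _     = trans (*-congˡ (xq _ t)) (zeroʳ _)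

  *ᴾ-YOnlyʳ : ∀ p q → YOnly q → ∀ i j → (p *ᴾ q) i j ≈ sumTo j (λ b → p i b * q 0 (j ∸ b))
  *ᴾ-YOnlyʳ p q yq i j = trans (sumTo-single i i ℕ.≤-refl off)
    (sumTo-cong j (λ b _ → *-congˡ (reflexive (≡.cong (λ t → q t (j ∸ b)) (ℕ.n∸n≡0 i)))))
    where
    off : ∀ a → a ≤ i → a ≢ i → sumTo j (λ b → p a b * q (i ∸ a) (j ∸ b)) ≈ 0#
    off a a≤i a≢i with i ∸ a | ∸≢0 a≤i a≢i
    ... | zero  | i∸a≢0 = ⊥-elim (i∸a≢0 ≡.refl)
    ... | suc t | _     = sumTo-≈0 j (λ b _ → trans (*-congˡ (yq t _)) (zeroʳ _))

  *ᴾ-XOnly-YOnly : ∀ p q → XOnly p → YOnly q → ∀ i j → (p *ᴾ q) i j ≈ p i 0 * q 0 j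
  *ᴾ-XOnly-YOnly p q xp yq i j = trans (*ᴾ-YOnlyʳ p q yq i j) (sumTo-single j 0 z≤n
    (λ { zero _ 0≢0 → ⊥-elim (0≢0 ≡.refl) ; (suc b) _ _ → trans (*-congʳ (xp i b)) (zeroˡ _) }))

  IsZeroᴾ : Pol → Set ℓ
  IsZeroᴾ p = ∀ i j → p i j ≈ 0#

  constᴾ-0# : IsZeroᴾ (constᴾ 0#)
  constᴾ-0# zero    zero    = refl
  constᴾ-0# zero    (suc j) = refl
  constᴾ-0# (suc i) j       = refl

  IsZeroᴾ-*ᴾˡ : ∀ {p} q → IsZeroᴾ p → IsZeroᴾ (p *ᴾ q)
  IsZeroᴾ-*ᴾˡ q p≈0 i j = sumTo²-≈0 i j (λ a b _ _ → trans (*-congʳ (p≈0 a b)) (zeroˡ _))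

  IsZeroᴾ-*ᴾʳ : ∀ p {q} → IsZeroᴾ q → IsZeroᴾ (p *ᴾ q)
  IsZeroᴾ-*ᴾʳ p q≈0 i j = sumTo²-≈0 i j (λ a b _ _ → trans (*-congˡ (q≈0 _ _)) (zeroʳ _))

  evalΠ-− : ∀ A B p q u v → evalΠ A B (λ i j → p i j - q i j) u v ≈ evalΠ A B p u v - evalΠ A B q u v
  evalΠ-− A B p q u v = trans
    (sumTo-cong A (λ i _ → trans (sumTo-cong B (λ j _ → [y-z]x≈yx-zx _ _ _)) (sumTo-− B _ _)))
    (sumTo-− A _ _)

  evalΠ-shrink : ∀ {m n} A B {p} → m ≤ A → n ≤ B → InΠ m n p → ∀ u v → evalΠ A B p u v ≈ evalΠ m n p u v
  evalΠ-shrink {m} {n} A B m≤A n≤B p∈Π u v = trans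
    (sumTo-extend m A m≤A (λ i m<i → sumTo-≈0 B (λ j _ → trans (*-congʳ (p∈Π i j (inj₁ m<i))) (zeroˡ _))))
    (sumTo-cong m (λ i _ → sumTo-extend n B n≤B (λ j n<j → trans (*-congʳ (p∈Π i j (inj₂ n<j))) (zeroˡ _))))

  evalΠ-≈0 : ∀ A B {p} → IsZeroᴾ p → ∀ u v → evalΠ A B p u v ≈ 0#
  evalΠ-≈0 A B p≈0 u v = sumTo²-≈0 A B (λ i j _ _ → trans (*-congʳ (p≈0 i j)) (zeroˡ _))

  evalΠ-sumTo² : ∀ A B C D (p : ℕ → ℕ → Pol) (κ : ℕ → ℕ → Carrier) u v →
    evalΠ A B (λ i j → sumTo C (λ m → sumTo D (λ n → p m n i j * κ m n))) u v
      ≈ sumTo C (λ m → sumTo D (λ n → κ m n * evalΠ A B (p m n) u v))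
  evalΠ-sumTo² A B C D p κ u v = begin
    sumTo A (λ i → sumTo B (λ j → sumTo C (λ m → sumTo D (λ n → p m n i j * κ m n)) * (u ^ i * v ^ j)))
      ≈⟨ sumTo-cong A (λ i _ → sumTo-cong B (λ j _ → trans (*-distribʳ-sumTo C _ _) (sumTo-cong C (λ m _ →
          trans (*-distribʳ-sumTo D _ _) (sumTo-cong D (λ n _ →
            solve 3 (λ p k w → p :* k :* w := k :* (p :* w)) refl _ _ _)))))) ⟩
    sumTo A (λ i → sumTo B (λ j → sumTo C (λ m → sumTo D (λ n → κ m n * (p m n i j * (u ^ i * v ^ j))))))
      ≈⟨ trans (sumTo-cong A (λ i _ → sumTo-swap₃ B C D _)) (sumTo-swap₃ A C D _) ⟩
    sumTo C (λ m → sumTo D (λ n → sumTo A (λ i → sumTo B (λ j → κ m n * (p m n i j * (u ^ i * v ^ j))))))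
      ≈⟨ sumTo-cong C (λ m _ → sumTo-cong D (λ n _ →
           sym (trans (*-distribˡ-sumTo A _ _) (sumTo-cong A (λ i _ → *-distribˡ-sumTo B _ _))))) ⟩
    sumTo C (λ m → sumTo D (λ n → κ m n * evalΠ A B (p m n) u v)) ∎

  iterΔxΔy-beyond-degree : ∀ m n {p} → InΠ m n p → ∀ i j → m < i ⊎ n < j → ∀ u v →
    iter Δx i (iter Δy j (evalΠ m n p)) u v ≈ 0#
  iterΔxΔy-beyond-degree m n {p} p∈Π i j beyond u v =
    trans (iterΔxΔy-evalΠ m n i j p u v) (evalΠ-≈0 m n (vanishes beyond) u v)
    where
    vanishes : m < i ⊎ n < j → IsZeroᴾ (iter (Δᶜx m) i (iter (Δᶜy n) j p))
    vanishes (inj₁ m<i) i′ j′ = iter-Δᶜx-XDegree m i (suc m)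
      (iter-Δᶜy-XDegree n j (suc m) (λ i′ j′ m<i′ → p∈Π i′ j′ (inj₁ m<i′))) i′ j′
      (≡.subst (_≤ i′) (≡.sym (ℕ.m≤n⇒m∸n≡0 m<i)) z≤n)
    vanishes (inj₂ n<j) i′ j′ = iter-Δᶜx-YDegree m i 0
      (λ i″ j″ _ → iter-Δᶜy-YDegree n j (suc n) (λ i‴ j‴ n<j‴ → p∈Π i‴ j‴ (inj₂ n<j‴)) i″ j″
        (≡.subst (_≤ j″) (≡.sym (ℕ.m≤n⇒m∸n≡0 n<j)) z≤n)) i′ j′ z≤n

  goncarov-Δ-everywhere : ∀ (Z : NodeSet) m n {p} → IsGoncarov Z m n p → ∀ i j →
    iter Δx i (iter Δy j (evalΠ m n p)) (proj₁ (Z i j)) (proj₂ (Z i j)) ≈ fromℕ (m !) * fromℕ (n !) * (δ m i * δ n j)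
  goncarov-Δ-everywhere Z m n (p∈Π , conditions) i j with i ≤? m | j ≤? n
  ... | yes i≤m | yes j≤n = conditions i j i≤m j≤n
  ... | no  i≰m | _       = trans (iterΔxΔy-beyond-degree m n p∈Π i j (inj₁ (ℕ.≰⇒> i≰m)) _ _)
    (sym (trans (*-congˡ (trans (*-congʳ (δ-≢ (i≰m ∘ ℕ.≤-reflexive ∘ ≡.sym))) (zeroˡ _))) (zeroʳ _)))
  ... | yes _   | no  j≰n = trans (iterΔxΔy-beyond-degree m n p∈Π i j (inj₂ (ℕ.≰⇒> j≰n)) _ _)
    (sym (trans (*-congˡ (trans (*-congˡ (δ-≢ (j≰n ∘ ℕ.≤-reflexive ∘ ≡.sym))) (zeroʳ _))) (zeroʳ _)))

  -- Rising factorials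

  -- The coefficient of t^(i+1) in f(t) · M(t), when M(t) = w + t.
  convolve-linear : ∀ (M f : ℕ → Carrier) w → M 0 ≈ w → M 1 ≈ 1# → (∀ t → M (2 ℕ.+ t) ≈ 0#) →
    ∀ i → sumTo (suc i) (λ a → f a * M (suc i ∸ a)) ≈ f i + f (suc i) * w
  convolve-linear M f w M₀ M₁ M₂₊ i = +-cong (trans (sumTo-single i i ℕ.≤-refl far) near) last
    where
    far : ∀ a → a ≤ i → a ≢ i → f a * M (suc i ∸ a) ≈ 0#
    far a a≤i a≢i with suc i ∸ a | ℕ.+-∸-assoc 1 a≤i | ∸≢0 a≤i a≢i
    ... | _ | ≡.refl | i∸a≢0 with i ∸ a
    ...   | zero  = ⊥-elim (i∸a≢0 ≡.refl)
    ...   | suc t = trans (*-congˡ (M₂₊ t)) (zeroʳ _)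
    near : f i * M (suc i ∸ i) ≈ f i
    near = trans (*-congˡ (trans (reflexive (≡.cong M (ℕ.m+n∸n≡m 1 i))) M₁)) (*-identityʳ _)
    last : f (suc i) * M (i ∸ i) ≈ f (suc i) * w
    last = *-congˡ (trans (reflexive (≡.cong M (ℕ.n∸n≡0 i))) M₀)

  x+ y+ : Carrier → Pol
  x+ w = Xᴾ +ᴾ constᴾ w
  y+ w = Yᴾ +ᴾ constᴾ w

  x+-XOnly : ∀ w → XOnly (x+ w)
  x+-XOnly w zero                j = +-identityʳ 0#
  x+-XOnly w (suc zero)          j = +-identityʳ 0#
  x+-XOnly w (suc (suc i))       j = +-identityʳ 0#

  y+-YOnly : ∀ w → YOnly (y+ w)
  y+-YOnly w i zero              = +-identityʳ 0#
  y+-YOnly w i (suc zero)        = +-identityʳ 0#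
  y+-YOnly w i (suc (suc j))     = +-identityʳ 0#

  *ᴾ-x+-zero : ∀ p w j → (p *ᴾ x+ w) 0 j ≈ p 0 j * w
  *ᴾ-x+-zero p w j = trans (*ᴾ-XOnlyʳ p (x+ w) (x+-XOnly w) 0 j) (*-congˡ (+-identityˡ w))

  *ᴾ-x+-suc : ∀ p w i j → (p *ᴾ x+ w) (suc i) j ≈ p i j + p (suc i) j * w
  *ᴾ-x+-suc p w i j = trans (*ᴾ-XOnlyʳ p (x+ w) (x+-XOnly w) (suc i) j)
    (convolve-linear (λ t → x+ w t 0) (λ a → p a j) w (+-identityˡ w) (+-identityʳ 1#) (λ _ → +-identityʳ 0#) i)

  *ᴾ-y+-zero : ∀ p w i → (p *ᴾ y+ w) i 0 ≈ p i 0 * w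
  *ᴾ-y+-zero p w i = trans (*ᴾ-YOnlyʳ p (y+ w) (y+-YOnly w) i 0) (*-congˡ (+-identityˡ w))

  *ᴾ-y+-suc : ∀ p w i j → (p *ᴾ y+ w) i (suc j) ≈ p i j + p i (suc j) * w
  *ᴾ-y+-suc p w i j = trans (*ᴾ-YOnlyʳ p (y+ w) (y+-YOnly w) i (suc j))
    (convolve-linear (λ t → y+ w 0 t) (p i) w (+-identityˡ w) (+-identityʳ 1#) (λ _ → +-identityʳ 0#) j)

  rising′ : Carrier → ℕ → Carrier
  rising′ u zero    = 1#
  rising′ u (suc k) = rising′ u k * (u + fromℕ k)

  rising′-cong : ∀ k {u u′} → u ≈ u′ → rising′ u k ≈ rising′ u′ k
  rising′-cong zero    u≈u′ = refl
  rising′-cong (suc k) u≈u′ = *-cong (rising′-cong k u≈u′) (+-congʳ u≈u′)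

  rising′-suc : ∀ w k → rising′ w (suc k) ≈ w * rising′ (w + 1#) k
  rising′-suc w zero    = trans (*-identityˡ _) (sym (trans (*-identityʳ w) (sym (+-identityʳ w))))
  rising′-suc w (suc k) = trans (*-congʳ (rising′-suc w k))
    (solve 4 (λ w r o f → w :* r :* (w :+ (o :+ f)) := w :* (r :* (w :+ o :+ f)))
      refl w (rising′ (w + 1#) k) 1# (fromℕ k))

  eval₁-*-linear : ∀ N (c r : ℕ → Carrier) w u → c (suc N) ≈ 0# →
    r 0 ≈ c 0 * w → (∀ i → r (suc i) ≈ c i + c (suc i) * w) →
    eval₁ (suc N) r u ≈ eval₁ (suc N) c u * (u + w)
  eval₁-*-linear N c r w u top≈0 r₀ rₛ = begin
    eval₁ (suc N) r u
      ≈⟨ sumTo-suc N _ ⟩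
    r 0 * 1# + sumTo N (λ i → r (suc i) * (u * u ^ i))
      ≈⟨ +-cong (*-congʳ r₀) (sumTo-cong N (λ i _ → *-congʳ (rₛ i))) ⟩
    c 0 * w * 1# + sumTo N (λ i → (c i + c (suc i) * w) * (u * u ^ i))
      ≈⟨ +-congˡ (trans (sumTo-cong N split) (sumTo-+ N _ _)) ⟩
    c 0 * w * 1# + (sumTo N (λ i → c i * u ^ i * u) + sumTo N (λ i → c (suc i) * u ^ suc i * w))
      ≈⟨ +-congˡ (+-cong (sym (*-distribʳ-sumTo N u _)) (sym (*-distribʳ-sumTo N w _))) ⟩
    c 0 * w * 1# + (eval₁ N c u * u + Y * w)
      ≈⟨ solve 6 (λ z w o e y v → z :* w :* o :+ (e :* v :+ y :* w) := e :* v :+ (z :* o :+ y) :* w)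
          refl (c 0) w 1# (eval₁ N c u) Y u ⟩
    eval₁ N c u * u + (c 0 * 1# + Y) * w
      ≈⟨ +-cong (*-congʳ (sym drop-top)) (*-congʳ (sym (sumTo-suc N _))) ⟩
    eval₁ (suc N) c u * u + eval₁ (suc N) c u * w
      ≈⟨ sym (distribˡ _ _ _) ⟩
    eval₁ (suc N) c u * (u + w) ∎
    where
    Y = sumTo N (λ i → c (suc i) * u ^ suc i)
    split : ∀ i → i ≤ N → (c i + c (suc i) * w) * (u * u ^ i) ≈ c i * u ^ i * u + c (suc i) * u ^ suc i * w
    split i _ = solve 5 (λ a b w u p → (a :+ b :* w) :* (u :* p) := a :* p :* u :+ b :* (u :* p) :* w)
      refl (c i) (c (suc i)) w u (u ^ i)
    drop-top : eval₁ (suc N) c u ≈ eval₁ N c u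
    drop-top = trans (+-congˡ (trans (*-congʳ top≈0) (zeroˡ _))) (+-identityʳ _)

  -- The hypotheses are the recurrence of the coefficients of u^(k+1) = u^(k) (u + k).
  module RisingCoefficients (q : ℕ → ℕ → Carrier) (q₀₀ : q 0 0 ≈ 1#) (q₀ₛ : ∀ i → q 0 (suc i) ≈ 0#)
      (qₛ₀ : ∀ k → q (suc k) 0 ≈ q k 0 * fromℕ k)
      (qₛₛ : ∀ k i → q (suc k) (suc i) ≈ q k i + q k (suc i) * fromℕ k) where

    degree : ∀ {k i} → k < i → q k i ≈ 0#
    degree {zero}  {suc i} _         = q₀ₛ i
    degree {suc k} {suc i} (s≤s k<i) =
      trans (qₛₛ k i) (trans (+-cong (degree k<i) (trans (*-congʳ (degree (ℕ.m≤n⇒m≤1+n k<i))) (zeroˡ _))) (+-identityʳ 0#))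

    eval₁-rising : ∀ N k u → k ≤ N → eval₁ N (q k) u ≈ rising′ u k
    eval₁-rising N zero u _ = trans
      (sumTo-single N 0 z≤n (λ { zero _ 0≢0 → ⊥-elim (0≢0 ≡.refl)
                               ; (suc i) _ _ → trans (*-congʳ (q₀ₛ i)) (zeroˡ _) }))
      (trans (*-congʳ q₀₀) (*-identityˡ _))
    eval₁-rising (suc N) (suc k) u (s≤s k≤N) = trans
      (eval₁-*-linear N (q k) (q (suc k)) (fromℕ k) u (degree (s≤s k≤N)) (qₛ₀ k) (qₛₛ k))
      (*-congʳ (eval₁-rising (suc N) k u (ℕ.m≤n⇒m≤1+n k≤N)))

  +-*-≈0 : ∀ {a b} w → a ≈ 0# → b ≈ 0# → a + b * w ≈ 0#
  +-*-≈0 w a≈0 b≈0 = trans (+-cong a≈0 (trans (*-congʳ b≈0) (zeroˡ w))) (+-identityʳ 0#)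

  rising-x-XOnly : ∀ k → XOnly (rising Xᴾ k)
  rising-x-XOnly zero    zero    j = refl
  rising-x-XOnly zero    (suc i) j = refl
  rising-x-XOnly (suc k) zero    j =
    trans (*ᴾ-x+-zero (rising Xᴾ k) (fromℕ k) (suc j)) (trans (*-congʳ (rising-x-XOnly k 0 j)) (zeroˡ _))
  rising-x-XOnly (suc k) (suc i) j =
    trans (*ᴾ-x+-suc (rising Xᴾ k) (fromℕ k) i (suc j)) (+-*-≈0 _ (rising-x-XOnly k i j) (rising-x-XOnly k (suc i) j))

  rising-y-YOnly : ∀ k → YOnly (rising Yᴾ k)
  rising-y-YOnly zero    i j       = refl
  rising-y-YOnly (suc k) i zero    =
    trans (*ᴾ-y+-zero (rising Yᴾ k) (fromℕ k) (suc i)) (trans (*-congʳ (rising-y-YOnly k i 0)) (zeroˡ _))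
  rising-y-YOnly (suc k) i (suc j) =
    trans (*ᴾ-y+-suc (rising Yᴾ k) (fromℕ k) (suc i) j) (+-*-≈0 _ (rising-y-YOnly k i j) (rising-y-YOnly k i (suc j)))

  module RisingX = RisingCoefficients (λ k i → rising Xᴾ k i 0) refl (λ _ → refl)
    (λ k → *ᴾ-x+-zero (rising Xᴾ k) (fromℕ k) 0) (λ k i → *ᴾ-x+-suc (rising Xᴾ k) (fromℕ k) i 0)
  module RisingY = RisingCoefficients (λ k j → rising Yᴾ k 0 j) refl (λ _ → refl)
    (λ k → *ᴾ-y+-zero (rising Yᴾ k) (fromℕ k) 0) (λ k j → *ᴾ-y+-suc (rising Yᴾ k) (fromℕ k) 0 j)

  -- (1 - s)^{-u} = Σ_k negBinom u k s^k
  negBinom : Carrier → ℕ → Carrier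
  negBinom u k = rising′ u k * invℕ (k !)

  oneMinusS^-x-XOnly : ∀ k → XOnly (oneMinusS^- Xᴾ k 0)
  oneMinusS^-x-XOnly k i j = trans (*ᴾ-constᴾ (rising Xᴾ k) _ i (suc j)) (trans (*-congʳ (rising-x-XOnly k i j)) (zeroˡ _))

  oneMinusT^-y-YOnly : ∀ k → YOnly (oneMinusT^- Yᴾ 0 k)
  oneMinusT^-y-YOnly k i j = trans (*ᴾ-constᴾ (rising Yᴾ k) _ (suc i) j) (trans (*-congʳ (rising-y-YOnly k i j)) (zeroˡ _))

  oneMinusS^-x-degree : ∀ {k i} → k < i → oneMinusS^- Xᴾ k 0 i 0 ≈ 0#
  oneMinusS^-x-degree {k} {i} k<i = trans (*ᴾ-constᴾ (rising Xᴾ k) _ i 0) (trans (*-congʳ (RisingX.degree k<i)) (zeroˡ _))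

  oneMinusT^-y-degree : ∀ {k j} → k < j → oneMinusT^- Yᴾ 0 k 0 j ≈ 0#
  oneMinusT^-y-degree {k} {j} k<j = trans (*ᴾ-constᴾ (rising Yᴾ k) _ 0 j) (trans (*-congʳ (RisingY.degree k<j)) (zeroˡ _))

  eval₁-oneMinusS^-x : ∀ k u → eval₁ k (λ i → oneMinusS^- Xᴾ k 0 i 0) u ≈ negBinom u k
  eval₁-oneMinusS^-x k u = begin
    eval₁ k (λ i → oneMinusS^- Xᴾ k 0 i 0) u
      ≈⟨ sumTo-cong k (λ i _ → trans (*-congʳ (*ᴾ-constᴾ (rising Xᴾ k) _ i 0))
          (solve 3 (λ a w p → a :* w :* p := a :* p :* w) refl _ _ _)) ⟩
    sumTo k (λ i → rising Xᴾ k i 0 * u ^ i * invℕ (k !))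
      ≈⟨ sym (*-distribʳ-sumTo k _ _) ⟩
    eval₁ k (λ i → rising Xᴾ k i 0) u * invℕ (k !)
      ≈⟨ *-congʳ (RisingX.eval₁-rising k k u ℕ.≤-refl) ⟩
    negBinom u k ∎

  eval₁-oneMinusT^-y : ∀ k v → eval₁ k (oneMinusT^- Yᴾ 0 k 0) v ≈ negBinom v k
  eval₁-oneMinusT^-y k v = begin
    eval₁ k (oneMinusT^- Yᴾ 0 k 0) v
      ≈⟨ sumTo-cong k (λ j _ → trans (*-congʳ (*ᴾ-constᴾ (rising Yᴾ k) _ 0 j))
          (solve 3 (λ a w p → a :* w :* p := a :* p :* w) refl _ _ _)) ⟩
    sumTo k (λ j → rising Yᴾ k 0 j * v ^ j * invℕ (k !))
      ≈⟨ sym (*-distribʳ-sumTo k _ _) ⟩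
    eval₁ k (rising Yᴾ k 0) v * invℕ (k !)
      ≈⟨ *-congʳ (RisingY.eval₁-rising k k v ℕ.≤-refl) ⟩
    negBinom v k ∎

  evalΠ-XOnly-*ᴾ-YOnly : ∀ A B p q → XOnly p → YOnly q → ∀ u v →
    evalΠ A B (p *ᴾ q) u v ≈ eval₁ A (λ i → p i 0) u * eval₁ B (q 0) v
  evalΠ-XOnly-*ᴾ-YOnly A B p q xp yq u v = begin
    evalΠ A B (p *ᴾ q) u v
      ≈⟨ sumTo-cong A (λ i _ → sumTo-cong B (λ j _ →
          trans (*-congʳ (*ᴾ-XOnly-YOnly p q xp yq i j)) (*-interchange _ _ _ _))) ⟩
    sumTo A (λ i → sumTo B (λ j → (p i 0 * u ^ i) * (q 0 j * v ^ j)))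
      ≈⟨ sumTo-cong A (λ i _ → sym (*-distribˡ-sumTo B _ _)) ⟩
    sumTo A (λ i → (p i 0 * u ^ i) * eval₁ B (q 0) v)
      ≈⟨ sym (*-distribʳ-sumTo A _ _) ⟩
    eval₁ A (λ i → p i 0) u * eval₁ B (q 0) v ∎

  rising-constᴾ : ∀ x k → rising (constᴾ x) k ≈ᴾ constᴾ (rising′ x k)
  rising-constᴾ x zero    i j = refl
  rising-constᴾ x (suc k) i j = trans (*ᴾ-cong (rising-constᴾ x k) (constᴾ-+ᴾ-constᴾ x (fromℕ k)) i j)
                                      (constᴾ-*ᴾ-constᴾ _ _ i j)

  oneMinusS^-constᴾ : ∀ x k → oneMinusS^- (constᴾ x) k 0 ≈ᴾ constᴾ (negBinom x k)
  oneMinusS^-constᴾ x k i j = trans (*ᴾ-congʳ (constᴾ _) (rising-constᴾ x k) i j) (constᴾ-*ᴾ-constᴾ _ _ i j)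

  oneMinusT^-constᴾ : ∀ y k → oneMinusT^- (constᴾ y) 0 k ≈ᴾ constᴾ (negBinom y k)
  oneMinusT^-constᴾ y k i j = trans (*ᴾ-congʳ (constᴾ _) (rising-constᴾ y k) i j) (constᴾ-*ᴾ-constᴾ _ _ i j)

  -- Power series in s and t

  SOnly : Ser → Set ℓ
  SOnly S = ∀ a b → IsZeroᴾ (S a (suc b))

  TOnly : Ser → Set ℓ
  TOnly T = ∀ a b → IsZeroᴾ (T (suc a) b)

  *ˢ-SOnly : ∀ S T → SOnly S → SOnly T → SOnly (S *ˢ T)
  *ˢ-SOnly S T sS sT a b i j = sumTo²-≈0 a (suc b) term
    where
    term : ∀ a′ b′ → a′ ≤ a → b′ ≤ suc b → (S a′ b′ *ᴾ T (a ∸ a′) (suc b ∸ b′)) i j ≈ 0#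
    term a′ zero     _ _ = IsZeroᴾ-*ᴾʳ (S a′ 0) (sT (a ∸ a′) b) i j
    term a′ (suc b′) _ _ = IsZeroᴾ-*ᴾˡ (T (a ∸ a′) (b ∸ b′)) (sS a′ b′) i j

  *ˢ-TOnly : ∀ S T → TOnly S → TOnly T → TOnly (S *ˢ T)
  *ˢ-TOnly S T tS tT a b i j = sumTo²-≈0 (suc a) b term
    where
    term : ∀ a′ b′ → a′ ≤ suc a → b′ ≤ b → (S a′ b′ *ᴾ T (suc a ∸ a′) (b ∸ b′)) i j ≈ 0#
    term zero     b′ _ _ = IsZeroᴾ-*ᴾʳ (S 0 b′) (tT a (b ∸ b′)) i j
    term (suc a′) b′ _ _ = IsZeroᴾ-*ᴾˡ (T (a ∸ a′) (b ∸ b′)) (tS a′ b′) i j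

  constˢ-SOnly : ∀ p → SOnly (constˢ p)
  constˢ-SOnly p zero    b = constᴾ-0#
  constˢ-SOnly p (suc a) b = constᴾ-0#

  constˢ-TOnly : ∀ p → TOnly (constˢ p)
  constˢ-TOnly p a b = constᴾ-0#

  monoˢ-SOnly : ∀ m → SOnly (monoˢ m 0)
  monoˢ-SOnly m a b with m ≟ a
  ... | yes _ = constᴾ-0#
  ... | no  _ = constᴾ-0#

  monoˢ-TOnly : ∀ n → TOnly (monoˢ 0 n)
  monoˢ-TOnly n a b = constᴾ-0#

  oneMinusS^-SOnly : ∀ p → SOnly (oneMinusS^- p)
  oneMinusS^-SOnly p a b = constᴾ-0#

  oneMinusT^-TOnly : ∀ p → TOnly (oneMinusT^- p)
  oneMinusT^-TOnly p a b = constᴾ-0#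

  SOnly-*ˢ-TOnly : ∀ S T → SOnly S → TOnly T → ∀ a b → (S *ˢ T) a b ≈ᴾ (S a 0 *ᴾ T 0 b)
  SOnly-*ˢ-TOnly S T sS tT a b i j = trans (sumTo²-single a b a 0 ℕ.≤-refl z≤n off)
    (reflexive (≡.cong (λ t → (S a 0 *ᴾ T t b) i j) (ℕ.n∸n≡0 a)))
    where
    off : ∀ a′ b′ → a′ ≤ a → b′ ≤ b → a′ ≢ a ⊎ b′ ≢ 0 → (S a′ b′ *ᴾ T (a ∸ a′) (b ∸ b′)) i j ≈ 0#
    off a′ (suc b′) _ _ _ = IsZeroᴾ-*ᴾˡ (T (a ∸ a′) (b ∸ suc b′)) (sS a′ b′) i j
    off a′ zero a′≤a _ (inj₂ 0≢0) = ⊥-elim (0≢0 ≡.refl)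
    off a′ zero a′≤a _ (inj₁ a′≢a) with a ∸ a′ | ∸≢0 a′≤a a′≢a
    ... | zero  | a∸a′≢0 = ⊥-elim (a∸a′≢0 ≡.refl)
    ... | suc t | _      = IsZeroᴾ-*ᴾʳ (S a′ 0) (tT t b) i j

  constˢ-≈0 : ∀ q {a b} → a ≢ 0 ⊎ b ≢ 0 → IsZeroᴾ (constˢ q a b)
  constˢ-≈0 q {zero}  {zero}  (inj₁ 0≢0) = ⊥-elim (0≢0 ≡.refl)
  constˢ-≈0 q {zero}  {zero}  (inj₂ 0≢0) = ⊥-elim (0≢0 ≡.refl)
  constˢ-≈0 q {zero}  {suc b} _          = constᴾ-0#
  constˢ-≈0 q {suc a} {b}     _          = constᴾ-0#

  monoˢ-≈0 : ∀ m n {a b} → a ≢ m ⊎ b ≢ n → IsZeroᴾ (monoˢ m n a b)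
  monoˢ-≈0 m n {a} {b} off with m ≟ a | n ≟ b
  ... | yes ≡.refl | yes ≡.refl = ⊥-elim ([ (λ a≢a → a≢a ≡.refl) , (λ b≢b → b≢b ≡.refl) ] off)
  ... | yes _      | no _       = constᴾ-0#
  ... | no _       | _          = constᴾ-0#

  monoˢ-diag : ∀ m n → monoˢ m n m n ≈ᴾ constᴾ 1#
  monoˢ-diag m n i j with m ≟ m | n ≟ n
  ... | yes _   | yes _   = refl
  ... | no m≢m | _       = ⊥-elim (m≢m ≡.refl)
  ... | yes _   | no n≢n = ⊥-elim (n≢n ≡.refl)

  *ˢ-constˢ : ∀ S q a b → (S *ˢ constˢ q) a b ≈ᴾ (S a b *ᴾ q)
  *ˢ-constˢ S q a b i j = trans
    (sumTo²-single a b a b ℕ.≤-refl ℕ.≤-refl (λ a′ b′ a′≤a b′≤b off →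
      IsZeroᴾ-*ᴾʳ (S a′ b′) (constˢ-≈0 q (∸≢0⊎∸≢0 a′≤a b′≤b off)) i j))
    (reflexive (≡.cong₂ (λ x y → (S a b *ᴾ constˢ q x y) i j) (ℕ.n∸n≡0 a) (ℕ.n∸n≡0 b)))

  constˢ-*ˢ : ∀ p S a b → (constˢ p *ˢ S) a b ≈ᴾ (p *ᴾ S a b)
  constˢ-*ˢ p S a b i j = sumTo²-single a b 0 0 z≤n z≤n (λ a′ b′ _ _ off →
    IsZeroᴾ-*ᴾˡ (S (a ∸ a′) (b ∸ b′)) (constˢ-≈0 p off) i j)

  monoˢ-*ˢ : ∀ m n S {a b} → m ≤ a → n ≤ b → (monoˢ m n *ˢ S) a b ≈ᴾ S (a ∸ m) (b ∸ n)
  monoˢ-*ˢ m n S {a} {b} m≤a n≤b i j = begin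
    (monoˢ m n *ˢ S) a b i j
      ≈⟨ sumTo²-single a b m n m≤a n≤b (λ a′ b′ _ _ off →
          IsZeroᴾ-*ᴾˡ (S (a ∸ a′) (b ∸ b′)) (monoˢ-≈0 m n off) i j) ⟩
    (monoˢ m n m n *ᴾ S (a ∸ m) (b ∸ n)) i j ≈⟨ *ᴾ-congʳ (S (a ∸ m) (b ∸ n)) (monoˢ-diag m n) i j ⟩
    (constᴾ 1# *ᴾ S (a ∸ m) (b ∸ n)) i j
      ≈⟨ trans (constᴾ-*ᴾ 1# (S (a ∸ m) (b ∸ n)) i j) (*-identityˡ _) ⟩
    S (a ∸ m) (b ∸ n) i j ∎

  -- shiftedNegBinom a m x is the coefficient of s^a in s^m (1 - s)^{-x} / m!.
  shiftedNegBinom : ℕ → ℕ → Carrier → Carrier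
  shiftedNegBinom a m x = negBinom x (a ∸ m) * invℕ (m !)

  goncarov-term-coeff : ∀ p x y m n {a b} → m ≤ a → n ≤ b →
    ((constˢ p *ˢ ((monoˢ m 0 *ˢ oneMinusS^- (constᴾ x)) *ˢ constˢ (constᴾ (invℕ (m !)))))
      *ˢ ((monoˢ 0 n *ˢ oneMinusT^- (constᴾ y)) *ˢ constˢ (constᴾ (invℕ (n !))))) a b
    ≈ᴾ (λ i j → p i j * (shiftedNegBinom a m x * shiftedNegBinom b n y))
  goncarov-term-coeff p x y m n {a} {b} m≤a n≤b i j = begin
    ((constˢ p *ˢ A) *ˢ B) a b i j
      ≈⟨ SOnly-*ˢ-TOnly (constˢ p *ˢ A) B (*ˢ-SOnly (constˢ p) A (constˢ-SOnly p) A-SOnly) B-TOnly a b i j ⟩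
    ((constˢ p *ˢ A) a 0 *ᴾ B 0 b) i j
      ≈⟨ *ᴾ-cong (λ i j → trans (constˢ-*ˢ p A a 0 i j) (*ᴾ-congˡ p A-coeff i j))
          B-coeff i j ⟩
    ((p *ᴾ constᴾ wx) *ᴾ constᴾ wy) i j
      ≈⟨ *ᴾ-constᴾ _ wy i j ⟩
    (p *ᴾ constᴾ wx) i j * wy
      ≈⟨ *-congʳ (*ᴾ-constᴾ p wx i j) ⟩
    p i j * wx * wy
      ≈⟨ *-assoc _ _ _ ⟩
    p i j * (wx * wy) ∎
    where
    Sx = oneMinusS^- (constᴾ x)
    Ty = oneMinusT^- (constᴾ y)
    A B : Ser
    A = (monoˢ m 0 *ˢ Sx) *ˢ constˢ (constᴾ (invℕ (m !)))
    B = (monoˢ 0 n *ˢ Ty) *ˢ constˢ (constᴾ (invℕ (n !)))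
    wx = shiftedNegBinom a m x
    wy = shiftedNegBinom b n y
    A-SOnly : SOnly A
    A-SOnly = *ˢ-SOnly (monoˢ m 0 *ˢ Sx) (constˢ (constᴾ (invℕ (m !))))
      (*ˢ-SOnly (monoˢ m 0) Sx (monoˢ-SOnly m) (oneMinusS^-SOnly (constᴾ x))) (constˢ-SOnly (constᴾ (invℕ (m !))))
    B-TOnly : TOnly B
    B-TOnly = *ˢ-TOnly (monoˢ 0 n *ˢ Ty) (constˢ (constᴾ (invℕ (n !))))
      (*ˢ-TOnly (monoˢ 0 n) Ty (monoˢ-TOnly n) (oneMinusT^-TOnly (constᴾ y))) (constˢ-TOnly (constᴾ (invℕ (n !))))
    A-coeff : A a 0 ≈ᴾ constᴾ wx
    A-coeff i j = begin
      A a 0 i j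
        ≈⟨ *ˢ-constˢ (monoˢ m 0 *ˢ Sx) _ a 0 i j ⟩
      ((monoˢ m 0 *ˢ Sx) a 0 *ᴾ constᴾ (invℕ (m !))) i j
        ≈⟨ *ᴾ-congʳ (constᴾ _) (λ i j → trans (monoˢ-*ˢ m 0 Sx {a} {0} m≤a z≤n i j)
            (oneMinusS^-constᴾ x (a ∸ m) i j)) i j ⟩
      (constᴾ (negBinom x (a ∸ m)) *ᴾ constᴾ (invℕ (m !))) i j ≈⟨ constᴾ-*ᴾ-constᴾ _ _ i j ⟩
      constᴾ wx i j ∎
    B-coeff : B 0 b ≈ᴾ constᴾ wy
    B-coeff i j = begin
      B 0 b i j
        ≈⟨ *ˢ-constˢ (monoˢ 0 n *ˢ Ty) _ 0 b i j ⟩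
      ((monoˢ 0 n *ˢ Ty) 0 b *ᴾ constᴾ (invℕ (n !))) i j
        ≈⟨ *ᴾ-congʳ (constᴾ _) (λ i j → trans (monoˢ-*ˢ 0 n Ty {0} {b} z≤n n≤b i j)
            (oneMinusT^-constᴾ y (b ∸ n) i j)) i j ⟩
      (constᴾ (negBinom y (b ∸ n)) *ᴾ constᴾ (invℕ (n !))) i j ≈⟨ constᴾ-*ᴾ-constᴾ _ _ i j ⟩
      constᴾ wy i j ∎

  -- Uniqueness of Gončarov interpolation and the coefficient identity

  module _ (char0 : CharZero) where

    fromℕ-!≉0 : ∀ k → ¬ fromℕ (k !) ≈ 0#
    fromℕ-!≉0 k = ≡.subst (λ n → ¬ fromℕ n ≈ 0#) (ℕ.suc-pred (k !) {{k ℕ.!≢0}}) (char0 (ℕ.pred (k !)))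

    fromℕ-!*y≈0⇒y≈0 : ∀ k {y} → fromℕ (k !) * y ≈ 0# → y ≈ 0#
    fromℕ-!*y≈0⇒y≈0 k {y} k!y≈0 = begin
      y
        ≈⟨ sym (*-identityˡ y) ⟩
      1# * y
        ≈⟨ *-congʳ (sym (trans (*-comm _ _) (⁻¹-inverse _ (fromℕ-!≉0 k)))) ⟩
      invℕ (k !) * fromℕ (k !) * y
        ≈⟨ *-assoc _ _ _ ⟩
      invℕ (k !) * (fromℕ (k !) * y)
        ≈⟨ *-congˡ k!y≈0 ⟩
      invℕ (k !) * 0#
        ≈⟨ zeroʳ _ ⟩
      0# ∎

    goncarov-unique₁ : ∀ B (w : ℕ → Carrier) {c} → DegreeBelow (suc B) c →
      (∀ j → j ≤ B → eval₁ B (iter (Δᶜ B) j c) (w j) ≈ 0#) → ∀ l → c l ≈ 0#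
    goncarov-unique₁ B w {c} deg vanish = backward-induction (λ l → c l ≈ 0#) (suc B) step deg
      where
      step : ∀ n → n < suc B → DegreeBelow (suc n) c → c n ≈ 0#
      step n n<1+B deg-n = fromℕ-!*y≈0⇒y≈0 n (begin
        fromℕ (n !) * c n
          ≈⟨ sym (iter-Δᶜ-leading B n deg-n n≤B) ⟩
        iter (Δᶜ B) n c 0
          ≈⟨ sym (eval₁-constant B (w n) Δⁿc-constant) ⟩
        eval₁ B (iter (Δᶜ B) n c) (w n)
          ≈⟨ vanish n n≤B ⟩
        0# ∎)
        where
        n≤B = ℕ.≤-pred n<1+B
        Δⁿc-constant : DegreeBelow 1 (iter (Δᶜ B) n c)
        Δⁿc-constant = ≡.subst (λ k → DegreeBelow k (iter (Δᶜ B) n c)) (ℕ.m+n∸n≡m 1 n) (iter-Δᶜ-degree B n (suc n) deg-n)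

    goncarov-unique : ∀ a b (Z : NodeSet) {W} → InΠ a b W →
      (∀ i j → i ≤ a → j ≤ b → iter Δx i (iter Δy j (evalΠ a b W)) (proj₁ (Z i j)) (proj₂ (Z i j)) ≈ 0#) →
      ∀ i j → W i j ≈ 0#
    goncarov-unique a b Z {W} W∈Π vanish =
      backward-induction (λ i → ∀ j → W i j ≈ 0#) (suc a) row-≈0 (λ i a<i j → W∈Π i j (inj₁ a<i))
      where
      row-≈0 : ∀ m → m < suc a → (∀ i → suc m ≤ i → ∀ j → W i j ≈ 0#) → ∀ j → W m j ≈ 0#
      row-≈0 m m<1+a rows-above-≈0 =
        goncarov-unique₁ b (λ j → proj₂ (Z m j)) (λ l b<l → W∈Π m l (inj₂ b<l)) row-vanish
        where
        m≤a = ℕ.≤-pred m<1+a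
        row-vanish : ∀ j → j ≤ b → eval₁ b (iter (Δᶜ b) j (W m)) (proj₂ (Z m j)) ≈ 0#
        row-vanish j j≤b = fromℕ-!*y≈0⇒y≈0 m (begin
          fromℕ (m !) * eval₁ b (iter (Δᶜ b) j (W m)) y
            ≈⟨ *-distribˡ-sumTo b _ _ ⟩
          sumTo b (λ l → fromℕ (m !) * (iter (Δᶜ b) j (W m) l * y ^ l))
            ≈⟨ sumTo-cong b (λ l _ → trans (sym (*-assoc _ _ _)) (*-congʳ (sym (R-row₀ l)))) ⟩
          eval₁ b (R 0) y
            ≈⟨ sym (*-identityʳ _) ⟩
          eval₁ b (R 0) y * x ^ 0
            ≈⟨ sym (sumTo-single a 0 z≤n higher-rows) ⟩
          sumTo a (λ i → eval₁ b (R i) y * x ^ i)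
            ≈⟨ sym (evalΠ-by-rows a b R x y) ⟩
          evalΠ a b R x y
            ≈⟨ sym (iterΔxΔy-evalΠ a b m j W x y) ⟩
          iter Δx m (iter Δy j (evalΠ a b W)) x y
            ≈⟨ vanish m j m≤a j≤b ⟩
          0# ∎)
          where
          x = proj₁ (Z m j)
          y = proj₂ (Z m j)
          V R : Pol
          V = iter (Δᶜy b) j W
          R = iter (Δᶜx a) m V
          V-degree : XDegreeBelow (suc m) V
          V-degree = iter-Δᶜy-XDegree b j (suc m) (λ i l 1+m≤i → rows-above-≈0 i 1+m≤i l)
          R-degree : XDegreeBelow 1 R
          R-degree = ≡.subst (λ k → XDegreeBelow k R) (ℕ.m+n∸n≡m 1 m) (iter-Δᶜx-XDegree a m (suc m) V-degree)
          R-row₀ : ∀ l → R 0 l ≈ fromℕ (m !) * iter (Δᶜ b) j (W m) l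
          R-row₀ l = trans (iter-Δᶜx-column a m V 0 l)
            (trans (iter-Δᶜ-leading a m (λ k 1+m≤k → V-degree k l 1+m≤k) m≤a) (*-congˡ (iter-Δᶜy-row b j W m l)))
          higher-rows : ∀ i → i ≤ a → i ≢ 0 → eval₁ b (R i) y * x ^ i ≈ 0#
          higher-rows i _ i≢0 =
            trans (*-congʳ (sumTo-≈0 b (λ l _ → trans (*-congʳ (R-degree i l (ℕ.n≢0⇒n>0 i≢0))) (zeroˡ _)))) (zeroˡ _)

    invℕ-!-suc : ∀ k → fromℕ (suc k) * invℕ (suc k !) ≈ invℕ (k !)
    invℕ-!-suc k = begin
      fromℕ (suc k) * invℕ (suc k !)
        ≈⟨ sym (*-identityˡ _) ⟩
      1# * (fromℕ (suc k) * invℕ (suc k !))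
        ≈⟨ *-congʳ (sym (trans (*-comm _ _) (⁻¹-inverse _ (fromℕ-!≉0 k)))) ⟩
      invℕ (k !) * fromℕ (k !) * (fromℕ (suc k) * invℕ (suc k !))
        ≈⟨ solve 4 (λ i f g j → i :* f :* (g :* j) := i :* (f :* g :* j)) refl _ _ _ _ ⟩
      invℕ (k !) * (fromℕ (k !) * fromℕ (suc k) * invℕ (suc k !))
        ≈⟨ *-congˡ (trans (*-congʳ (sym (fromℕ-!-suc k))) (⁻¹-inverse _ (fromℕ-!≉0 (suc k)))) ⟩
      invℕ (k !) * 1#
        ≈⟨ *-identityʳ _ ⟩
      invℕ (k !) ∎

    ∇₁-negBinom : ∀ k v → negBinom v (suc k) - negBinom (v - 1#) (suc k) ≈ negBinom v k
    ∇₁-negBinom k v = begin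
      rising′ v k * (v + fromℕ k) * I - rising′ (v - 1#) (suc k) * I
        ≈⟨ +-congˡ (-‿cong (*-congʳ (trans (rising′-suc (v - 1#) k) (*-congˡ (rising′-cong k v-1+1≈v))))) ⟩
      rising′ v k * (v + fromℕ k) * I - (v - 1#) * rising′ v k * I
        ≈⟨ solve 5 (λ r v f o i → r :* (v :+ f) :* i :- (v :- o) :* r :* i := r :* ((o :+ f) :* i))
             refl (rising′ v k) v (fromℕ k) 1# I ⟩
      rising′ v k * (fromℕ (suc k) * I)
        ≈⟨ *-congˡ (invℕ-!-suc k) ⟩
      negBinom v k ∎
      where
      I = invℕ (suc k !)
      v-1+1≈v : v - 1# + 1# ≈ v
      v-1+1≈v = solve 2 (λ v o → v :- o :+ o := v) refl v 1#

    iter-∇₁-negBinom : ∀ k j → j ≤ k → ∀ v → iter ∇₁ j (λ w → negBinom w k) v ≈ negBinom v (k ∸ j)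
    iter-∇₁-negBinom k       zero    _         v = refl
    iter-∇₁-negBinom (suc k) (suc j) (s≤s j≤k) v = begin
      iter ∇₁ j N v - iter ∇₁ j N (v - 1#)
        ≈⟨ +-cong (iter-∇₁-negBinom (suc k) j j≤1+k v) (-‿cong (iter-∇₁-negBinom (suc k) j j≤1+k (v - 1#))) ⟩
      negBinom v (suc k ∸ j) - negBinom (v - 1#) (suc k ∸ j)
        ≡⟨ ≡.cong (λ l → negBinom v l - negBinom (v - 1#) l) (ℕ.+-∸-assoc 1 j≤k) ⟩
      negBinom v (suc (k ∸ j)) - negBinom (v - 1#) (suc (k ∸ j))
        ≈⟨ ∇₁-negBinom (k ∸ j) v ⟩
      negBinom v (k ∸ j) ∎
      where
      N = λ w → negBinom w (suc k)
      j≤1+k = ℕ.m≤n⇒m≤1+n j≤k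

    module GoncarovExpansion (Z : NodeSet) (g : ℕ → ℕ → Pol) (goncarov : ∀ m n → IsGoncarov Z m n (g m n))
                             (a b : ℕ) where

      x y : ℕ → ℕ → Carrier
      x m n = proj₁ (Z m n)
      y m n = proj₂ (Z m n)

      κ : ℕ → ℕ → Carrier
      κ m n = shiftedNegBinom a m (x m n) * shiftedNegBinom b n (y m n)

      -- P and R are the coefficients of s^a t^b on the two sides of the theorem.
      Sₐ Tᵦ P R W : Pol
      Sₐ = oneMinusS^- Xᴾ a 0
      Tᵦ = oneMinusT^- Yᴾ 0 b
      P = Sₐ *ᴾ Tᵦ
      R i j = sumTo a (λ m → sumTo b (λ n → g m n i j * κ m n))
      W i j = P i j - R i j

      W∈Π : InΠ a b W
      W∈Π i j beyond = trans (+-cong P≈0 (-‿cong R≈0)) (trans (+-identityˡ _) ε⁻¹≈ε)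
        where
        P≈0 : P i j ≈ 0#
        P≈0 = trans (*ᴾ-XOnly-YOnly Sₐ Tᵦ (oneMinusS^-x-XOnly a) (oneMinusT^-y-YOnly b) i j) (factor≈0 beyond)
          where
          factor≈0 : a < i ⊎ b < j → Sₐ i 0 * Tᵦ 0 j ≈ 0#
          factor≈0 (inj₁ a<i) = trans (*-congʳ (oneMinusS^-x-degree a<i)) (zeroˡ _)
          factor≈0 (inj₂ b<j) = trans (*-congˡ (oneMinusT^-y-degree b<j)) (zeroʳ _)
        R≈0 : R i j ≈ 0#
        R≈0 = sumTo²-≈0 a b (λ m n m≤a n≤b →
          trans (*-congʳ (proj₁ (goncarov m n) i j (beyond-mn m≤a n≤b beyond))) (zeroˡ _))
          where
          beyond-mn : ∀ {m n} → m ≤ a → n ≤ b → a < i ⊎ b < j → m < i ⊎ n < j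
          beyond-mn m≤a _ (inj₁ a<i) = inj₁ (ℕ.≤-<-trans m≤a a<i)
          beyond-mn _ n≤b (inj₂ b<j) = inj₂ (ℕ.≤-<-trans n≤b b<j)

      fP fR : Fn
      fP u v = negBinom u a * negBinom v b
      fR u v = sumTo a (λ m → sumTo b (λ n → κ m n * evalΠ m n (g m n) u v))

      evalΠ-W : evalΠ a b W ≈ᶠ (λ u v → fP u v - fR u v)
      evalΠ-W u v = trans (evalΠ-− a b P R u v) (+-cong evalΠ-P (-‿cong evalΠ-R))
        where
        evalΠ-P : evalΠ a b P u v ≈ fP u v
        evalΠ-P = trans (evalΠ-XOnly-*ᴾ-YOnly a b Sₐ Tᵦ (oneMinusS^-x-XOnly a) (oneMinusT^-y-YOnly b) u v)
                        (*-cong (eval₁-oneMinusS^-x a u) (eval₁-oneMinusT^-y b v))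
        evalΠ-R : evalΠ a b R u v ≈ fR u v
        evalΠ-R = trans (evalΠ-sumTo² a b a b g κ u v) (sumTo-cong a (λ m m≤a → sumTo-cong b (λ n n≤b →
                    *-congˡ (evalΠ-shrink a b m≤a n≤b (proj₁ (goncarov m n)) u v))))

      Δ-fP : ∀ i j → i ≤ a → j ≤ b → iter Δx i (iter Δy j fP) ≈ᶠ (λ u v → negBinom u (a ∸ i) * negBinom v (b ∸ j))
      Δ-fP i j i≤a j≤b u v = trans (iter-Δx-cong i (iter-Δy-product j _ _) u v)
        (trans (iter-Δx-product i _ _ u v) (*-cong (iter-∇₁-negBinom a i i≤a u) (iter-∇₁-negBinom b j j≤b v)))

      Δ-fR : ∀ i j → i ≤ a → j ≤ b → iter Δx i (iter Δy j fR) (x i j) (y i j) ≈ κ i j * (fromℕ (i !) * fromℕ (j !))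
      Δ-fR i j i≤a j≤b = begin
        iter Δx i (iter Δy j fR) (x i j) (y i j)
          ≈⟨ iter-Δx-cong i (iter-Δy-sumTo² j a b κ E) _ _ ⟩
        iter Δx i (λ u v → sumTo a (λ m → sumTo b (λ n → κ m n * iter Δy j (E m n) u v))) (x i j) (y i j)
          ≈⟨ iter-Δx-sumTo² i a b κ (λ m n → iter Δy j (E m n)) _ _ ⟩
        sumTo a (λ m → sumTo b (λ n → κ m n * iter Δx i (iter Δy j (E m n)) (x i j) (y i j)))
          ≈⟨ sumTo-cong a (λ m _ → sumTo-cong b (λ n _ → *-congˡ (goncarov-Δ-everywhere Z m n (goncarov m n) i j))) ⟩
        sumTo a (λ m → sumTo b (λ n → κ m n * (fromℕ (m !) * fromℕ (n !) * (δ m i * δ n j))))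
          ≈⟨ sumTo²-single a b i j i≤a j≤b (λ m n _ _ off →
               trans (*-congˡ (trans (*-congˡ (δδ≈0 off)) (zeroʳ _))) (zeroʳ _)) ⟩
        κ i j * (fromℕ (i !) * fromℕ (j !) * (δ i i * δ j j))
          ≈⟨ *-congˡ (trans (*-congˡ (trans (*-cong (δ-refl i) (δ-refl j)) (*-identityˡ 1#))) (*-identityʳ _)) ⟩
        κ i j * (fromℕ (i !) * fromℕ (j !)) ∎
        where
        E : ℕ → ℕ → Fn
        E m n = evalΠ m n (g m n)
        δδ≈0 : ∀ {m n} → m ≢ i ⊎ n ≢ j → δ m i * δ n j ≈ 0#
        δδ≈0 (inj₁ m≢i) = trans (*-congʳ (δ-≢ m≢i)) (zeroˡ _)
        δδ≈0 (inj₂ n≢j) = trans (*-congˡ (δ-≢ n≢j)) (zeroʳ _)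

      κ-factorials : ∀ i j → κ i j * (fromℕ (i !) * fromℕ (j !)) ≈ negBinom (x i j) (a ∸ i) * negBinom (y i j) (b ∸ j)
      κ-factorials i j = begin
        (nx * invℕ (i !)) * (ny * invℕ (j !)) * (fromℕ (i !) * fromℕ (j !))
          ≈⟨ solve 6 (λ p q r s t w → p :* r :* (q :* s) :* (t :* w) := p :* q :* ((t :* r) :* (w :* s)))
               refl nx ny (invℕ (i !)) (invℕ (j !)) (fromℕ (i !)) (fromℕ (j !)) ⟩
        nx * ny * ((fromℕ (i !) * invℕ (i !)) * (fromℕ (j !) * invℕ (j !)))
          ≈⟨ *-congˡ (trans (*-cong (⁻¹-inverse _ (fromℕ-!≉0 i)) (⁻¹-inverse _ (fromℕ-!≉0 j))) (*-identityˡ 1#)) ⟩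
        nx * ny * 1#
          ≈⟨ *-identityʳ _ ⟩
        nx * ny ∎
        where
        nx = negBinom (x i j) (a ∸ i)
        ny = negBinom (y i j) (b ∸ j)

      W-conditions : ∀ i j → i ≤ a → j ≤ b → iter Δx i (iter Δy j (evalΠ a b W)) (x i j) (y i j) ≈ 0#
      W-conditions i j i≤a j≤b = begin
        iter Δx i (iter Δy j (evalΠ a b W)) (x i j) (y i j)
          ≈⟨ iter-Δx-cong i (iter-Δy-cong j evalΠ-W) _ _ ⟩
        iter Δx i (iter Δy j (λ u v → fP u v - fR u v)) (x i j) (y i j)
          ≈⟨ trans (iter-Δx-cong i (iter-Δy-− j fP fR) _ _) (iter-Δx-− i _ _ _ _) ⟩
        iter Δx i (iter Δy j fP) (x i j) (y i j) - iter Δx i (iter Δy j fR) (x i j) (y i j)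
          ≈⟨ +-cong (Δ-fP i j i≤a j≤b _ _) (-‿cong (trans (Δ-fR i j i≤a j≤b) (κ-factorials i j))) ⟩
        negBinom (x i j) (a ∸ i) * negBinom (y i j) (b ∸ j) - negBinom (x i j) (a ∸ i) * negBinom (y i j) (b ∸ j)
          ≈⟨ -‿inverseʳ _ ⟩
        0# ∎

      P≈R : P ≈ᴾ R
      P≈R i j = x∙y⁻¹≈ε⇒x≈y _ _ (goncarov-unique a b Z W∈Π W-conditions i j)

theorem4 : ∀ {c ℓ} (F : Field c ℓ) → let open WithField F in
    CharZero → (Z : NodeSet) → (g : ℕ → ℕ → Pol) →
    (∀ m n → IsGoncarov Z m n (g m n)) →
    (oneMinusS^- Xᴾ *ˢ oneMinusT^- Yᴾ)
      ≈ˢ sumˢ (λ m n →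
            ((constˢ (g m n)
              *ˢ ((monoˢ m 0 *ˢ oneMinusS^- (constᴾ (proj₁ (Z m n))))
                   *ˢ constˢ (constᴾ (invℕ (m !)))))
              *ˢ ((monoˢ 0 n *ˢ oneMinusT^- (constᴾ (proj₂ (Z m n))))
                   *ˢ constˢ (constᴾ (invℕ (n !))))))
theorem4 F char0 Z g goncarov a b i j = begin
  (oneMinusS^- Xᴾ *ˢ oneMinusT^- Yᴾ) a b i j
    ≈⟨ SOnly-*ˢ-TOnly F (oneMinusS^- Xᴾ) (oneMinusT^- Yᴾ) (oneMinusS^-SOnly F Xᴾ) (oneMinusT^-TOnly F Yᴾ) a b i j ⟩
  (oneMinusS^- Xᴾ a 0 *ᴾ oneMinusT^- Yᴾ 0 b) i j
    ≈⟨ GoncarovExpansion.P≈R F char0 Z g goncarov a b i j ⟩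
  sumTo a (λ m → sumTo b (λ n →
    g m n i j * (shiftedNegBinom F a m (proj₁ (Z m n)) * shiftedNegBinom F b n (proj₂ (Z m n)))))
    ≈⟨ sumTo-cong F a (λ m m≤a → sumTo-cong F b (λ n n≤b →
        sym (goncarov-term-coeff F (g m n) (proj₁ (Z m n)) (proj₂ (Z m n)) m n m≤a n≤b i j))) ⟩
  _ ∎
  where
  open Field F
  open WithField F
  open SetoidReasoning setoid
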